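{- Let $n \geq 1$ and $r \geq 2$ be integers. For $\mathbf{m}=(m_1,\dots,m_n)\in \mathbb{N}^n$ let $\mathcal{W}(\mathbf{m})$ be the set of words over the alphabet $\{1,\dots,n\}$ containing exactly $m_i$ copies of the letter $i$ for each $i$, and let $$g_r(\mathbf{m};t)=\sum_{w\in\mathcal{W}(\mathbf{m})} t^{\alpha(w)},$$ where $\alpha(w)$ is the number of occurrences in $w$ of the consecutive pattern $12\cdots r$, i.e. the number of indices $i$ with $w_i<w_{i+1}<\dots<w_{i+r-1}$. Define polynomials $P^{(r)}_k(t)$ for integers $k\ge 1$ by $P^{(r)}_k(t)=0$ if $k<r$, $P^{(r)}_r(t)=t-1$, and $P^{(r)}_k(t)=(t-1)\sum_{i=1}^{r-1}P^{(r)}_{k-i}(t)$ for $k>r$. Then the generating function $$G_r(x_1,\dots,x_n;t)=\sum_{\mathbf{m}\in\mathbb{N}^n} g_r(\mathbf{m};t)\,x_1^{m_1}\cdots x_n^{m_n}$$ satisfies $$G_r(x_1,\dots,x_n;t)=\frac{1}{1-e_1-\sum_{k=r}^{n}P^{(r)}_k(t)\,e_k},$$ where $e_k$ denotes the elementary symmetric polynomial of degree $k$ in $x_1,\dots,x_n$.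
   Context: Words are finite sequences $w=w_1w_2\cdots w_L$ of letters from $\{1,\dots,n\}$; patterns are counted consecutively (as contiguous factors). The elementary symmetric polynomial $e_k$ is the coefficient of $z^k$ in $(1+x_1z)\cdots(1+x_nz)$. -}

module Defs where

open import Data.Nat as ℕ using (ℕ; zero; suc; _≤?_; _<?_; _≟_; _∸_)
open import Data.Fin as Fin using (Fin)
import Data.Fin.Properties as FinP
open import Data.List using (List; []; _∷_; map; concatMap; filter; length; take; tails; allFin; upTo; foldr)
open import Data.Nat.ListAction using () renaming (sum to sumℕ)
open import Data.List.Relation.Unary.Linked using (Linked; linked?)
open import Data.Vec.Functional using (head; tail) renaming (_∷_ to _∷ᶠ_)
open import Data.Bool using (if_then_else_)
open import Relation.Nullary using (does)
open import Algebra.Bundles using (CommutativeRing)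

-- Words over the alphabet {1,…,n}, represented as lists over Fin n
-- (letter i+1 of the paper is Fin element i; order is the usual one).

allWords : (n L : ℕ) → List (List (Fin n))
allWords n zero    = [] ∷ []
allWords n (suc L) = concatMap (λ a → map (a ∷_) (allWords n L)) (allFin n)

count : ∀ {n} → Fin n → List (Fin n) → ℕ
count i w = length (filter (λ x → x Fin.≟ i) w)

size : ∀ {n} → (Fin n → ℕ) → ℕ
size {n} m = sumℕ (map m (allFin n))

𝒲 : (n : ℕ) → (Fin n → ℕ) → List (List (Fin n))
𝒲 n m = filter (λ w → FinP.all? (λ i → count i w ≟ m i)) (allWords n (size m))

windows : ∀ {n} → ℕ → List (Fin n) → List (List (Fin n))
windows r w = map (take r) (filter (λ u → r ≤? length u) (tails w))

α : ∀ {n} → ℕ → List (Fin n) → ℕ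
α r w = length (filter (linked? Fin._<?_) (windows r w))

-- Everything ring-valued: t is an element of an arbitrary commutative
-- ring R (equivalently, t an indeterminate: take R = ℤ[t]).

module Series {c ℓ} (R : CommutativeRing c ℓ) where
  open CommutativeRing R

  Σ : List Carrier → Carrier
  Σ = foldr _+_ 0#

  pow : Carrier → ℕ → Carrier
  pow x zero    = 1#
  pow x (suc k) = x * pow x k

  -- formal power series in x_1,…,x_n : coefficient of x^m for each m ∈ ℕ^n
  FPS : ℕ → Set c
  FPS n = (Fin n → ℕ) → Carrier

  box : (n : ℕ) → (Fin n → ℕ) → List (Fin n → ℕ)
  box zero    m = (λ ()) ∷ []
  box (suc n) m = concatMap (λ i → map (i ∷ᶠ_) (box n (tail m))) (upTo (suc (head m)))

  _⊕_ : ∀ {n} → FPS n → FPS n → FPS n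
  (f ⊕ g) m = f m + g m

  ⊖_ : ∀ {n} → FPS n → FPS n
  (⊖ f) m = - f m

  _⊛_ : ∀ {n} → FPS n → FPS n → FPS n
  _⊛_ {n} f g m = Σ (map (λ a → f a * g (λ i → m i ∸ a i)) (box n m))

  _·_ : ∀ {n} → Carrier → FPS n → FPS n
  (x · f) m = x * f m

  𝟘 : ∀ {n} → FPS n
  𝟘 m = 0#

  𝟙 : ∀ {n} → FPS n
  𝟙 {n} m = if does (FinP.all? (λ i → m i ≟ 0)) then 1# else 0#

  e : ∀ {n} → ℕ → FPS n
  e {n} k m =
    if does (FinP.all? (λ i → m i ≤? 1)) then
      (if does (size m ≟ k) then 1# else 0#)
    else 0#

  g : (n r : ℕ) → Carrier → (Fin n → ℕ) → Carrier
  g n r t m = Σ (map (λ w → pow t (α r w)) (𝒲 n m))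

  G : (n r : ℕ) → Carrier → FPS n
  G n r t = g n r t

  -- Ps r t k = [P_k, P_{k-1}, …, P_1]  (P_j = P^{(r)}_j(t))
  Ps : ℕ → Carrier → ℕ → List Carrier
  Ps r t zero    = []
  Ps r t (suc k) = p ∷ prev
    where
    prev = Ps r t k
    p = if does (suc k <? r) then 0#
        else if does (suc k ≟ r) then t - 1#
        else (t - 1#) * Σ (take (r ∸ 1) prev)

  -- P^{(r)}_k(t) for k ≥ 1  (value at k = 0 is irrelevant and set to 0)
  P : ℕ → Carrier → ℕ → Carrier
  P r t k with Ps r t k
  ... | []    = 0#
  ... | x ∷ _ = x

  sumPe : (n r : ℕ) → Carrier → FPS n
  sumPe n r t = foldr (λ k acc → (P r t k · e k) ⊕ acc) 𝟘
                      (map (r ℕ.+_) (upTo (suc n ∸ r)))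

  D : (n r : ℕ) → Carrier → FPS n
  D n r t = 𝟙 ⊕ (⊖ (e 1 ⊕ sumPe n r t))

module Submission where

-- Put c_1 = 1 and c_k = P_k (k ≥ 2). The coefficient of x^b in e_1 + Σ P_k e_k
-- is C(b) = [b ∈ {0,1}^n] · c_{|b|}, so the theorem says g(0) = 1 and
-- g(m) = Σ_{a ≤ m} g(a) · C(m - a) for m ≠ 0. This recursion follows from the
-- weight expansion of a nonempty word v,
--   t^{α(v)} = Σ_{k ≥ 1} [v_1 < ⋯ < v_k] · c_k · t^{α(v_{k+1} ⋯)},
-- summed over the words of content m and cut as v = u·w with |u| = k, since
-- the increasing words u of content b number [b ∈ {0,1}^n] · [|b| = k]. If the
-- maximal increasing prefix of v has length ℓ, then α(v_{k+1} ⋯) =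
-- α(v_{ℓ+1} ⋯) + (ℓ+1-r-k)⁺ for k ≤ ℓ, which reduces the expansion to
-- Σ_{k=1}^{ℓ} c_k t^{(ℓ+1-r-k)⁺} = t^{(ℓ+1-r)⁺}, proved from the recursion of P.

open import Defs
open import Data.Nat using (ℕ; _≤_)
open import Data.Fin using (Fin)
open import Algebra.Bundles using (CommutativeRing)

open import Data.Nat using (zero; suc; _<_; z≤n; s≤s; _∸_; _≤?_; _<?_; _≟_) renaming (_+_ to _+ℕ_)
import Data.Nat.Properties as NP
open import Data.Nat.ListAction using () renaming (sum to sumℕ)
open import Data.Fin as Fin using (toℕ)
import Data.Fin.Properties as FinP
open import Data.List using (List; []; _∷_; map; concatMap; filter; length; take; drop; allFin; upTo; foldr; applyUpTo; _++_; concat)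
import Data.List.Properties as LP
open import Data.List.Relation.Unary.Linked as Linked using (Linked; linked?)
open import Data.List.Relation.Unary.All as All using (All; all?)
open import Data.Vec.Functional using (head; tail) renaming (_∷_ to _∷ᶠ_)
open import Data.Bool using (if_then_else_)
open import Relation.Nullary using (Dec; yes; no; does; ¬_)
open import Relation.Nullary.Decidable using (_×-dec_; _→-dec_)
open import Relation.Binary using (tri<; tri≈; tri>)
open import Relation.Binary.PropositionalEquality as ≡ using (_≡_)
open import Data.Product using (∃; _×_; _,_; proj₁; proj₂)
open import Data.Empty using (⊥; ⊥-elim)
open import Function using (_∘_; id)
open import Algebra.Properties.CommutativeSemigroup NP.+-commutativeSemigroup using () renaming (interchange to +ℕ-interchange)

if-yes : ∀ {a p} {A : Set a} {Q : Set p} (d : Dec Q) {x y : A} → Q → (if does d then x else y) ≡ x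
if-yes (yes _) _ = ≡.refl
if-yes (no ¬q) q = ⊥-elim (¬q q)

if-no : ∀ {a p} {A : Set a} {Q : Set p} (d : Dec Q) {x y : A} → ¬ Q → (if does d then x else y) ≡ y
if-no (yes q) ¬q = ⊥-elim (¬q q)
if-no (no _)  _  = ≡.refl

range : ℕ → ℕ → List ℕ
range s zero    = []
range s (suc N) = s ∷ range (suc s) N

applyUpTo≡range : ∀ {f : ℕ → ℕ} s N → (∀ i → f i ≡ s +ℕ i) → applyUpTo f N ≡ range s N
applyUpTo≡range s zero    f≡ = ≡.refl
applyUpTo≡range {f} s (suc N) f≡ = ≡.cong₂ _∷_ (≡.trans (f≡ 0) (NP.+-identityʳ s))
  (applyUpTo≡range {f ∘ suc} (suc s) N (λ i → ≡.trans (f≡ (suc i)) (NP.+-suc s i)))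

allFin-suc : ∀ {b} {B : Set b} n (f : Fin (suc n) → B) →
  map f (allFin (suc n)) ≡ f Fin.zero ∷ map (f ∘ Fin.suc) (allFin n)
allFin-suc n f = ≡.cong (f Fin.zero ∷_)
  (≡.trans (LP.map-tabulate Fin.suc f) (≡.sym (LP.map-tabulate id (f ∘ Fin.suc))))

size-suc : ∀ {n} (a : Fin (suc n) → ℕ) → size a ≡ a Fin.zero +ℕ size (a ∘ Fin.suc)
size-suc {n} a = ≡.cong sumℕ (allFin-suc n a)

size-cong : ∀ {n} {a b : Fin n → ℕ} → (∀ i → a i ≡ b i) → size a ≡ size b
size-cong {n} a≗b = ≡.cong sumℕ (LP.map-cong a≗b (allFin n))

size-+ : ∀ {n} (a b : Fin n → ℕ) → size (λ i → a i +ℕ b i) ≡ size a +ℕ size b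
size-+ {zero}  a b = ≡.refl
size-+ {suc n} a b = begin
  size (λ i → a i +ℕ b i)                               ≡⟨ size-suc (λ i → a i +ℕ b i) ⟩
  (a₀ +ℕ b₀) +ℕ size (λ i → a (Fin.suc i) +ℕ b (Fin.suc i)) ≡⟨ ≡.cong ((a₀ +ℕ b₀) +ℕ_) (size-+ (a ∘ Fin.suc) (b ∘ Fin.suc)) ⟩
  (a₀ +ℕ b₀) +ℕ (size (a ∘ Fin.suc) +ℕ size (b ∘ Fin.suc)) ≡⟨ +ℕ-interchange a₀ b₀ _ _ ⟩
  (a₀ +ℕ size (a ∘ Fin.suc)) +ℕ (b₀ +ℕ size (b ∘ Fin.suc)) ≡⟨ ≡.sym (≡.cong₂ _+ℕ_ (size-suc a) (size-suc b)) ⟩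
  size a +ℕ size b ∎
  where
  open ≡.≡-Reasoning
  a₀ b₀ : ℕ
  a₀ = a Fin.zero
  b₀ = b Fin.zero

size-zero : ∀ {n} (a : Fin n → ℕ) → (∀ i → a i ≡ 0) → size a ≡ 0
size-zero {zero}  a a≗0 = ≡.refl
size-zero {suc n} a a≗0 = ≡.trans (size-suc a) (≡.cong₂ _+ℕ_ (a≗0 Fin.zero) (size-zero (a ∘ Fin.suc) (a≗0 ∘ Fin.suc)))

size-zero⁻ : ∀ {n} (a : Fin n → ℕ) → size a ≡ 0 → ∀ i → a i ≡ 0
size-zero⁻ {suc n} a |a|≡0 Fin.zero    = NP.m+n≡0⇒m≡0 (a Fin.zero) (≡.trans (≡.sym (size-suc a)) |a|≡0)
size-zero⁻ {suc n} a |a|≡0 (Fin.suc i) =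
  size-zero⁻ (a ∘ Fin.suc) (NP.m+n≡0⇒n≡0 (a Fin.zero) (≡.trans (≡.sym (size-suc a)) |a|≡0)) i

size-01 : ∀ {n} (a : Fin n → ℕ) → (∀ i → a i ≤ 1) → size a ≤ n
size-01 {zero}  a a≤1 = z≤n
size-01 {suc n} a a≤1 = ≡.subst (_≤ suc n) (≡.sym (size-suc a))
  (NP.+-mono-≤ (a≤1 Fin.zero) (size-01 (a ∘ Fin.suc) (a≤1 ∘ Fin.suc)))

size-∸ : ∀ {n} (m a : Fin n → ℕ) → (∀ i → a i ≤ m i) → size (λ i → m i ∸ a i) +ℕ size a ≡ size m
size-∸ m a a≤m = ≡.trans (≡.sym (size-+ (λ i → m i ∸ a i) a)) (size-cong (λ i → NP.m∸n+n≡m (a≤m i)))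

unitVec : ∀ {n} → Fin n → Fin n → ℕ
unitVec x i = if does (x Fin.≟ i) then 1 else 0

decrement : ∀ {n} → Fin n → (Fin n → ℕ) → Fin n → ℕ
decrement x a i = a i ∸ unitVec x i

unitVec-at : ∀ {n} (x : Fin n) → unitVec x x ≡ 1
unitVec-at x = if-yes (x Fin.≟ x) ≡.refl

unitVec-elsewhere : ∀ {n} (x i : Fin n) → ¬ i ≡ x → unitVec x i ≡ 0
unitVec-elsewhere x i i≢x = if-no (x Fin.≟ i) (i≢x ∘ ≡.sym)

size-unitVec : ∀ {n} (x : Fin n) → size (unitVec x) ≡ 1
size-unitVec {suc n} Fin.zero = ≡.trans (size-suc (unitVec {suc n} Fin.zero))
  (≡.cong suc (size-zero (unitVec {suc n} Fin.zero ∘ Fin.suc) (λ _ → ≡.refl)))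
size-unitVec {suc n} (Fin.suc x) = ≡.trans (size-suc (unitVec (Fin.suc x)))
  (≡.trans (size-cong {b = unitVec x} shift) (size-unitVec x))
  where
  shift : ∀ i → unitVec (Fin.suc x) (Fin.suc i) ≡ unitVec x i
  shift i with x Fin.≟ i
  ... | yes _ = ≡.refl
  ... | no _  = ≡.refl

unitVec≤ : ∀ {n} (x : Fin n) (a : Fin n → ℕ) → 1 ≤ a x → ∀ i → unitVec x i ≤ a i
unitVec≤ x a ax≥1 i with x Fin.≟ i
... | yes ≡.refl = ax≥1
... | no _       = z≤n

decrement-at : ∀ {n} (x : Fin n) (a : Fin n → ℕ) → decrement x a x ≡ a x ∸ 1
decrement-at x a = ≡.cong (a x ∸_) (unitVec-at x)

decrement-elsewhere : ∀ {n} (x i : Fin n) (a : Fin n → ℕ) → ¬ i ≡ x → decrement x a i ≡ a i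
decrement-elsewhere x i a i≢x = ≡.cong (a i ∸_) (unitVec-elsewhere x i i≢x)

decrement+unitVec : ∀ {n} (x : Fin n) (a : Fin n → ℕ) → 1 ≤ a x → ∀ i → decrement x a i +ℕ unitVec x i ≡ a i
decrement+unitVec x a ax≥1 i = NP.m∸n+n≡m (unitVec≤ x a ax≥1 i)

size-decrement : ∀ {n} (x : Fin n) (a : Fin n → ℕ) → 1 ≤ a x → size a ≡ suc (size (decrement x a))
size-decrement x a ax≥1 = begin
  size a                                   ≡⟨ size-cong (λ i → ≡.sym (decrement+unitVec x a ax≥1 i)) ⟩
  size (λ i → decrement x a i +ℕ unitVec x i) ≡⟨ size-+ (decrement x a) (unitVec x) ⟩
  size (decrement x a) +ℕ size (unitVec x)  ≡⟨ ≡.cong (size (decrement x a) +ℕ_) (size-unitVec x) ⟩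
  size (decrement x a) +ℕ 1                 ≡⟨ NP.+-comm _ 1 ⟩
  suc (size (decrement x a)) ∎
  where open ≡.≡-Reasoning

first-nonzero : ∀ {n} (a : Fin n → ℕ) → 1 ≤ size a →
  ∃ λ i → 1 ≤ a i × (∀ j → toℕ j < toℕ i → a j ≡ 0)
first-nonzero {zero} a ()
first-nonzero {suc n} a |a|≥1 with a Fin.zero ≟ 0
... | no a₀≢0 = Fin.zero , NP.n≢0⇒n>0 a₀≢0 , (λ j ())
... | yes a₀≡0 with first-nonzero (a ∘ Fin.suc)
                      (≡.subst (1 ≤_) (≡.trans (size-suc a) (≡.cong (_+ℕ size (a ∘ Fin.suc)) a₀≡0)) |a|≥1)
... | i , ai≥1 , before-i = Fin.suc i , ai≥1 , before-suc-i
  where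
  before-suc-i : ∀ j → toℕ j < toℕ (Fin.suc i) → a j ≡ 0
  before-suc-i Fin.zero    _        = a₀≡0
  before-suc-i (Fin.suc j) (s≤s lt) = before-i j lt

-- Occurrences of 12⋯r and maximal increasing prefixes

module _ {n : ℕ} where

  headOcc : ℕ → List (Fin n) → ℕ
  headOcc r u = if does (r ≤? length u) then (if does (linked? Fin._<?_ (take r u)) then 1 else 0) else 0

  α-cons : ∀ r x (w : List (Fin n)) → α r (x ∷ w) ≡ headOcc r (x ∷ w) +ℕ α r w
  α-cons r x w = by-cases (r ≤? length (x ∷ w)) (linked? Fin._<?_ (take r (x ∷ w)))
    where
    long? : (u : List (Fin n)) → Dec (r ≤ length u)
    long? u = r ≤? length u
    occurrencesIn : List (List (Fin n)) → ℕ
    occurrencesIn us = length (filter (linked? Fin._<?_) (map (take r) us))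
    by-cases : Dec (r ≤ length (x ∷ w)) → Dec (Linked Fin._<_ (take r (x ∷ w))) →
      α r (x ∷ w) ≡ headOcc r (x ∷ w) +ℕ α r w
    by-cases (no short) _ = ≡.trans (≡.cong occurrencesIn (LP.filter-reject long? short))
      (≡.sym (≡.cong (_+ℕ α r w) (if-no (r ≤? length (x ∷ w)) short)))
    by-cases (yes long) (yes inc) = ≡.trans (≡.cong occurrencesIn (LP.filter-accept long? long))
      (≡.trans (≡.cong length (LP.filter-accept (linked? Fin._<?_) inc))
        (≡.sym (≡.cong (_+ℕ α r w) (≡.trans (if-yes (r ≤? length (x ∷ w)) long) (if-yes (linked? Fin._<?_ (take r (x ∷ w))) inc)))))
    by-cases (yes long) (no ¬inc) = ≡.trans (≡.cong occurrencesIn (LP.filter-accept long? long))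
      (≡.trans (≡.cong length (LP.filter-reject (linked? Fin._<?_) ¬inc))
        (≡.sym (≡.cong (_+ℕ α r w) (≡.trans (if-yes (r ≤? length (x ∷ w)) long) (if-no (linked? Fin._<?_ (take r (x ∷ w))) ¬inc)))))

  run : List (Fin n) → ℕ
  run []          = 0
  run (x ∷ [])    = 1
  run (x ∷ y ∷ v) = if does (x Fin.<? y) then suc (run (y ∷ v)) else 1

  run-ascent : ∀ x y v → x Fin.< y → run (x ∷ y ∷ v) ≡ suc (run (y ∷ v))
  run-ascent x y v x<y = if-yes (x Fin.<? y) x<y

  run-descent : ∀ x y v → ¬ x Fin.< y → run (x ∷ y ∷ v) ≡ 1
  run-descent x y v x≮y = if-no (x Fin.<? y) x≮y

  run-≥1 : ∀ x v → 1 ≤ run (x ∷ v)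
  run-≥1 x []      = NP.≤-refl
  run-≥1 x (y ∷ v) with x Fin.<? y
  ... | yes x<y rewrite run-ascent x y v x<y  = s≤s z≤n
  ... | no x≮y  rewrite run-descent x y v x≮y = s≤s z≤n

  run-≤-length : ∀ v → run v ≤ length v
  run-≤-length []          = z≤n
  run-≤-length (x ∷ [])    = NP.≤-refl
  run-≤-length (x ∷ y ∷ v) = step (x Fin.<? y) (run-≤-length (y ∷ v))
    where
    step : Dec (x Fin.< y) → run (y ∷ v) ≤ length (y ∷ v) → run (x ∷ y ∷ v) ≤ length (x ∷ y ∷ v)
    step (yes x<y) ih = ≡.subst (_≤ length (x ∷ y ∷ v)) (≡.sym (run-ascent x y v x<y)) (s≤s ih)
    step (no x≮y)  _  = ≡.subst (_≤ length (x ∷ y ∷ v)) (≡.sym (run-descent x y v x≮y)) (s≤s z≤n)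

  increasing-prefix⇒≤run : ∀ k v → 1 ≤ k → k ≤ length v → Linked Fin._<_ (take k v) → k ≤ run v
  increasing-prefix⇒≤run (suc zero)    (x ∷ v)     _ _ _ = run-≥1 x v
  increasing-prefix⇒≤run (suc (suc k)) (x ∷ [])    _ (s≤s ()) _
  increasing-prefix⇒≤run (suc (suc k)) (x ∷ y ∷ v) _ (s≤s k≤) (x<y Linked.∷ inc)
    rewrite run-ascent x y v x<y = s≤s (increasing-prefix⇒≤run (suc k) (y ∷ v) (s≤s z≤n) k≤ inc)

  ≤run⇒increasing-prefix : ∀ k v → 1 ≤ k → k ≤ run v → (k ≤ length v) × Linked Fin._<_ (take k v)
  ≤run⇒increasing-prefix (suc zero)    (x ∷ v)     _ _ = s≤s z≤n , Linked.[-]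
  ≤run⇒increasing-prefix (suc (suc k)) (x ∷ [])    _ (s≤s ())
  ≤run⇒increasing-prefix (suc (suc k)) (x ∷ y ∷ v) _ k≤run =
    step (x Fin.<? y) (≤run⇒increasing-prefix (suc k) (y ∷ v) (s≤s z≤n))
    where
    step : Dec (x Fin.< y) → (suc k ≤ run (y ∷ v) → (suc k ≤ length (y ∷ v)) × Linked Fin._<_ (take (suc k) (y ∷ v))) →
      (suc (suc k) ≤ length (x ∷ y ∷ v)) × Linked Fin._<_ (take (suc (suc k)) (x ∷ y ∷ v))
    step (yes x<y) ih = let (k≤ , inc) = ih (NP.≤-pred (≡.subst (suc (suc k) ≤_) (run-ascent x y v x<y) k≤run)) in
      s≤s k≤ , (x<y Linked.∷ inc)
    step (no x≮y) _ with ≡.subst (suc (suc k) ≤_) (run-descent x y v x≮y) k≤run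
    ... | s≤s ()

  headOcc-run : ∀ r v → 1 ≤ r → headOcc r v ≡ (if does (r ≤? run v) then 1 else 0)
  headOcc-run r v r≥1 = by-cases (r ≤? run v) (r ≤? length v)
    where
    by-cases : Dec (r ≤ run v) → Dec (r ≤ length v) → headOcc r v ≡ (if does (r ≤? run v) then 1 else 0)
    by-cases (yes r≤run) _ = let (r≤ , inc) = ≤run⇒increasing-prefix r v r≥1 r≤run in
      ≡.trans (if-yes (r ≤? length v) r≤)
        (≡.trans (if-yes (linked? Fin._<?_ (take r v)) inc) (≡.sym (if-yes (r ≤? run v) r≤run)))
    by-cases (no r≰run) (no r≰) = ≡.trans (if-no (r ≤? length v) r≰) (≡.sym (if-no (r ≤? run v) r≰run))
    by-cases (no r≰run) (yes r≤) = ≡.trans (if-yes (r ≤? length v) r≤)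
      (≡.trans (if-no (linked? Fin._<?_ (take r v)) (λ inc → r≰run (increasing-prefix⇒≤run r v r≥1 r≤ inc)))
        (≡.sym (if-no (r ≤? run v) r≰run)))

  run-drop : ∀ k v → k < run v → run (drop k v) ≡ run v ∸ k
  run-drop zero    v           _ = ≡.refl
  run-drop (suc k) (x ∷ [])    (s≤s ())
  run-drop (suc k) (x ∷ y ∷ v) k<run with x Fin.<? y
  ... | yes x<y rewrite run-ascent x y v x<y = run-drop k (y ∷ v) (NP.≤-pred k<run)
  ... | no x≮y rewrite run-descent x y v x≮y with k<run
  ...   | s≤s ()

  drop-cons : ∀ k (v : List (Fin n)) → k < length v → ∃ λ x → drop k v ≡ x ∷ drop (suc k) v
  drop-cons zero    (x ∷ v) _ = x , ≡.refl
  drop-cons (suc k) (x ∷ v) k< = drop-cons k v (NP.≤-pred k<)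

-- One step of α-drop: with q = (ℓ + 1 - r)⁺ and k < ℓ,
-- [r ≤ ℓ - k] + (q - (k + 1))⁺ = (q - k)⁺.
occurrence-step : ∀ ℓ k r → k < ℓ →
  (if does (r ≤? ℓ ∸ k) then 1 else 0) +ℕ ((suc ℓ ∸ r) ∸ suc k) ≡ (suc ℓ ∸ r) ∸ k
occurrence-step ℓ k r k<ℓ = by-cases (r ≤? ℓ ∸ k)
  where
  by-cases : Dec (r ≤ ℓ ∸ k) → (if does (r ≤? ℓ ∸ k) then 1 else 0) +ℕ ((suc ℓ ∸ r) ∸ suc k) ≡ (suc ℓ ∸ r) ∸ k
  by-cases (yes r≤) = ≡.trans (≡.cong (_+ℕ ((suc ℓ ∸ r) ∸ suc k)) (if-yes (r ≤? ℓ ∸ k) r≤))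
                              (≡.sym (NP.+-∸-assoc 1 k<q))
    where
    k<q : k < suc ℓ ∸ r
    k<q = NP.m+n≤o⇒m≤o∸n (suc k)
            (≡.subst (_≤ suc ℓ) (≡.cong suc (NP.+-comm r k)) (s≤s (NP.m≤o∸n⇒m+n≤o r (NP.<⇒≤ k<ℓ) r≤)))
  by-cases (no r≰) = ≡.trans (≡.cong (_+ℕ ((suc ℓ ∸ r) ∸ suc k)) (if-no (r ≤? ℓ ∸ k) r≰))
                             (≡.trans (NP.m≤n⇒m∸n≡0 (NP.≤-trans q≤k (NP.n≤1+n k))) (≡.sym (NP.m≤n⇒m∸n≡0 q≤k)))
    where
    q≤k : suc ℓ ∸ r ≤ k
    q≤k = ≡.subst (suc ℓ ∸ r ≤_) (NP.m+n∸m≡n r k)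
            (NP.∸-monoˡ-≤ r (≡.subst (_≤ r +ℕ k) (≡.cong suc (NP.m∸n+n≡m (NP.<⇒≤ k<ℓ))) (NP.+-monoˡ-≤ k (NP.≰⇒> r≰))))

module _ {n : ℕ} where

  -- Inside the maximal increasing prefix (length ℓ = run v) the occurrences
  -- of 12⋯r (r ≥ 1) are exactly those starting at positions ≤ ℓ + 1 - r:
  -- for k ≤ ℓ, α(v_{k+1} ⋯) = α(v_{ℓ+1} ⋯) + (ℓ + 1 - r - k)⁺.
  -- Proved by downward induction on k, writing k = ℓ - d.
  α-drop : ∀ r (v : List (Fin n)) → 1 ≤ r → ∀ d k → k +ℕ d ≡ run v →
    α r (drop k v) ≡ α r (drop (run v) v) +ℕ ((suc (run v) ∸ r) ∸ k)
  α-drop r v r≥1 zero k k+0≡ℓ = begin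
    α r (drop k v)                                            ≡⟨ ≡.cong (λ z → α r (drop z v)) k≡ℓ ⟩
    α r (drop (run v) v)                                      ≡⟨ NP.+-identityʳ _ ⟨
    α r (drop (run v) v) +ℕ 0                                 ≡⟨ ≡.cong (α r (drop (run v) v) +ℕ_) (NP.m≤n⇒m∸n≡0 q≤k) ⟨
    α r (drop (run v) v) +ℕ ((suc (run v) ∸ r) ∸ k) ∎
    where
    open ≡.≡-Reasoning
    k≡ℓ : k ≡ run v
    k≡ℓ = ≡.trans (≡.sym (NP.+-identityʳ k)) k+0≡ℓ
    q≤k : suc (run v) ∸ r ≤ k
    q≤k = ≡.subst (suc (run v) ∸ r ≤_) (≡.sym k≡ℓ) (NP.∸-monoʳ-≤ (suc (run v)) r≥1)
  α-drop r v r≥1 (suc d) k k+d≡ℓ with drop-cons k v (NP.<-≤-trans k<ℓ (run-≤-length v))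
    where
    k<ℓ : k < run v
    k<ℓ = ≡.subst (k <_) k+d≡ℓ (NP.m<m+n k (s≤s z≤n))
  ... | x , drop-k = begin
    α r (drop k v)                                    ≡⟨ ≡.cong (α r) drop-k ⟩
    α r (x ∷ drop (suc k) v)                          ≡⟨ α-cons r x (drop (suc k) v) ⟩
    headOcc r (x ∷ drop (suc k) v) +ℕ α r (drop (suc k) v)
      ≡⟨ ≡.cong₂ _+ℕ_ (≡.trans (≡.cong (headOcc r) (≡.sym drop-k)) (headOcc-run r (drop k v) r≥1))
                      (α-drop r v r≥1 d (suc k) (≡.trans (≡.sym (NP.+-suc k d)) k+d≡ℓ)) ⟩
    (if does (r ≤? run (drop k v)) then 1 else 0) +ℕ (A +ℕ (q ∸ suc k))
      ≡⟨ ≡.cong (λ z → (if does (r ≤? z) then 1 else 0) +ℕ (A +ℕ (q ∸ suc k))) (run-drop k v k<ℓ) ⟩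
    B +ℕ (A +ℕ (q ∸ suc k))                           ≡⟨ NP.+-assoc B A _ ⟨
    (B +ℕ A) +ℕ (q ∸ suc k)                           ≡⟨ ≡.cong (_+ℕ (q ∸ suc k)) (NP.+-comm B A) ⟩
    (A +ℕ B) +ℕ (q ∸ suc k)                           ≡⟨ NP.+-assoc A B _ ⟩
    A +ℕ (B +ℕ (q ∸ suc k))                           ≡⟨ ≡.cong (A +ℕ_) (occurrence-step (run v) k r k<ℓ) ⟩
    A +ℕ (q ∸ k) ∎
    where
    open ≡.≡-Reasoning
    A q B : ℕ
    A = α r (drop (run v) v)
    q = suc (run v) ∸ r
    B = if does (r ≤? run v ∸ k) then 1 else 0
    k<ℓ : k < run v
    k<ℓ = ≡.subst (k <_) k+d≡ℓ (NP.m<m+n k (s≤s z≤n))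

_≗?_ : ∀ {n} (a b : Fin n → ℕ) → Dec (∀ i → a i ≡ b i)
a ≗? b = FinP.all? (λ i → a i ≟ b i)

count-cons : ∀ {n} (i x : Fin n) u → count i (x ∷ u) ≡ unitVec x i +ℕ count i u
count-cons i x u = by-cases (x Fin.≟ i)
  where
  by-cases : Dec (x ≡ i) → count i (x ∷ u) ≡ unitVec x i +ℕ count i u
  by-cases (yes x≡i) = ≡.trans (≡.cong length (LP.filter-accept (Fin._≟ i) x≡i))
    (≡.sym (≡.cong (_+ℕ count i u) (if-yes (x Fin.≟ i) x≡i)))
  by-cases (no x≢i) = ≡.trans (≡.cong length (LP.filter-reject (Fin._≟ i) x≢i))
    (≡.sym (≡.cong (_+ℕ count i u) (if-no (x Fin.≟ i) x≢i)))

count-++ : ∀ {n} (i : Fin n) u w → count i (u ++ w) ≡ count i u +ℕ count i w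
count-++ i u w = ≡.trans (≡.cong length (LP.filter-++ (Fin._≟ i) u w)) (LP.length-++ (filter (Fin._≟ i) u))

take-++ : ∀ {a} {A : Set a} (u w : List A) → take (length u) (u ++ w) ≡ u
take-++ []      w = ≡.refl
take-++ (x ∷ u) w = ≡.cong (x ∷_) (take-++ u w)

drop-++ : ∀ {a} {A : Set a} (u w : List A) → drop (length u) (u ++ w) ≡ w
drop-++ []      w = ≡.refl
drop-++ (x ∷ u) w = drop-++ u w

module _ {n : ℕ} where

  content-cons⇒ : ∀ (x : Fin n) u b → (∀ i → count i (x ∷ u) ≡ b i) →
    1 ≤ b x × (∀ i → count i u ≡ decrement x b i)
  content-cons⇒ x u b content = bx≥1 , content-u
    where
    bx≥1 : 1 ≤ b x
    bx≥1 = ≡.subst (1 ≤_) (≡.trans (≡.sym (count-cons x x u)) (content x)) (≡.subst (_≤ unitVec x x +ℕ count x u)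
             (unitVec-at x) (NP.m≤m+n (unitVec x x) (count x u)))
    content-u : ∀ i → count i u ≡ decrement x b i
    content-u i = ≡.trans (≡.sym (NP.m+n∸m≡n (unitVec x i) (count i u)))
                          (≡.cong (_∸ unitVec x i) (≡.trans (≡.sym (count-cons i x u)) (content i)))

  content-cons⇐ : ∀ (x : Fin n) u b → 1 ≤ b x → (∀ i → count i u ≡ decrement x b i) →
    ∀ i → count i (x ∷ u) ≡ b i
  content-cons⇐ x u b bx≥1 content-u i = begin
    count i (x ∷ u)                   ≡⟨ count-cons i x u ⟩
    unitVec x i +ℕ count i u          ≡⟨ ≡.cong (unitVec x i +ℕ_) (content-u i) ⟩
    unitVec x i +ℕ decrement x b i    ≡⟨ NP.+-comm (unitVec x i) _ ⟩
    decrement x b i +ℕ unitVec x i    ≡⟨ decrement+unitVec x b bx≥1 i ⟩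
    b i ∎
    where open ≡.≡-Reasoning

  IncreasingWord : ℕ → (Fin n → ℕ) → List (Fin n) → Set
  IncreasingWord lo b u = Linked Fin._<_ u × All (λ x → lo ≤ toℕ x) u × (∀ i → count i u ≡ b i)

  increasingWord? : ∀ lo b u → Dec (IncreasingWord lo b u)
  increasingWord? lo b u = linked? Fin._<?_ u ×-dec all? (λ x → lo ≤? toℕ x) u ×-dec ((λ i → count i u) ≗? b)

  Indicator : ℕ → (Fin n → ℕ) → ℕ → Set
  Indicator lo b k = (∀ i → b i ≤ 1) × size b ≡ k × (∀ i → toℕ i < lo → b i ≡ 0)

  indicator? : ∀ lo b k → Dec (Indicator lo b k)
  indicator? lo b k = FinP.all? (λ i → b i ≤? 1) ×-dec size b ≟ k ×-dec FinP.all? (λ i → (toℕ i <? lo) →-dec (b i ≟ 0))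

  Admissible : ℕ → (Fin n → ℕ) → Fin n → Set
  Admissible lo b x = lo ≤ toℕ x × 1 ≤ b x

  admissible? : ∀ lo b x → Dec (Admissible lo b x)
  admissible? lo b x = (lo ≤? toℕ x) ×-dec (1 ≤? b x)

  private
    linked-tail : ∀ {x : Fin n} {u} → Linked Fin._<_ (x ∷ u) → Linked Fin._<_ u
    linked-tail Linked.[-]     = Linked.[]
    linked-tail (_ Linked.∷ l) = l

    linked-head : ∀ (x : Fin n) u → Linked Fin._<_ (x ∷ u) → All (x Fin.<_) u
    linked-head x []      _                    = All.[]
    linked-head x (y ∷ u) (x<y Linked.∷ inc) = x<y All.∷ All.map (NP.<-trans x<y) (linked-head y u inc)

    linked-cons : ∀ (x : Fin n) u → Linked Fin._<_ u → All (λ y → suc (toℕ x) ≤ toℕ y) u → Linked Fin._<_ (x ∷ u)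
    linked-cons x []      _   _              = Linked.[-]
    linked-cons x (y ∷ u) inc (x<y All.∷ _) = x<y Linked.∷ inc

  increasing-cons⇒ : ∀ lo b (x : Fin n) u → IncreasingWord lo b (x ∷ u) →
    Admissible lo b x × IncreasingWord (suc (toℕ x)) (decrement x b) u
  increasing-cons⇒ lo b x u (inc , (lo≤x All.∷ lo≤u) , content) =
    let (bx≥1 , content-u) = content-cons⇒ x u b content in
    (lo≤x , bx≥1) , linked-tail inc , linked-head x u inc , content-u

  increasing-cons⇐ : ∀ lo b (x : Fin n) u → Admissible lo b x →
    IncreasingWord (suc (toℕ x)) (decrement x b) u → IncreasingWord lo b (x ∷ u)
  increasing-cons⇐ lo b x u (lo≤x , bx≥1) (inc , x<u , content-u) =
    linked-cons x u inc x<u ,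
    (lo≤x All.∷ All.map (λ x<y → NP.≤-trans lo≤x (NP.<⇒≤ x<y)) x<u) ,
    content-cons⇐ x u b bx≥1 content-u

  -- A (k+1)-element set of letters ≥ lo has exactly one admissible first
  -- letter x whose removal leaves a k-element set of letters > x: its minimum.
  FirstLetter : ℕ → (Fin n → ℕ) → ℕ → Fin n → Set
  FirstLetter lo b k x = Admissible lo b x × Indicator (suc (toℕ x)) (decrement x b) k

  firstLetter? : ∀ lo b k x → Dec (FirstLetter lo b k x)
  firstLetter? lo b k x = admissible? lo b x ×-dec indicator? (suc (toℕ x)) (decrement x b) k

  firstLetter⇒indicator : ∀ lo b k x → FirstLetter lo b k x → Indicator lo b (suc k)
  firstLetter⇒indicator lo b k x ((lo≤x , bx≥1) , (d≤1 , |d|≡k , d≡0)) = b≤1 , |b|≡ , b≡0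
    where
    b≤1 : ∀ i → b i ≤ 1
    b≤1 i with i Fin.≟ x
    ... | yes ≡.refl = NP.m∸n≡0⇒m≤n (≡.trans (≡.sym (decrement-at x b)) (d≡0 x NP.≤-refl))
    ... | no i≢x     = ≡.subst (_≤ 1) (decrement-elsewhere x i b i≢x) (d≤1 i)
    |b|≡ : size b ≡ suc k
    |b|≡ = ≡.trans (size-decrement x b bx≥1) (≡.cong suc |d|≡k)
    b≡0 : ∀ i → toℕ i < lo → b i ≡ 0
    b≡0 i i<lo = ≡.trans (≡.sym (decrement-elsewhere x i b i≢x)) (d≡0 i (NP.≤-trans i<lo (NP.≤-trans lo≤x (NP.n≤1+n _))))
      where
      i≢x : ¬ i ≡ x
      i≢x ≡.refl = NP.<⇒≱ i<lo lo≤x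

  -- If x < y and y is a first letter, b_x = 0, so x is not one.
  firstLetter-minimal : ∀ lo b k x y → toℕ x < toℕ y → FirstLetter lo b k x → FirstLetter lo b k y → ⊥
  firstLetter-minimal lo b k x y x<y ((_ , bx≥1) , _) (_ , (_ , _ , d≡0)) = NP.<⇒≱ bx≥1 (NP.≤-reflexive
    (≡.trans (≡.sym (decrement-elsewhere y x b (λ x≡y → NP.<-irrefl (≡.cong toℕ x≡y) x<y)))
             (d≡0 x (NP.≤-trans x<y (NP.n≤1+n _)))))

  firstLetter-unique : ∀ lo b k x y → FirstLetter lo b k x → FirstLetter lo b k y → x ≡ y
  firstLetter-unique lo b k x y fx fy with NP.<-cmp (toℕ x) (toℕ y)
  ... | tri< x<y _ _ = ⊥-elim (firstLetter-minimal lo b k x y x<y fx fy)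
  ... | tri≈ _ x≡y _ = FinP.toℕ-injective x≡y
  ... | tri> _ _ y<x = ⊥-elim (firstLetter-minimal lo b k y x y<x fy fx)

  firstLetter-exists : ∀ lo b k → Indicator lo b (suc k) → ∃ (FirstLetter lo b k)
  firstLetter-exists lo b k (b≤1 , |b|≡ , b≡0) with first-nonzero b (≡.subst (1 ≤_) (≡.sym |b|≡) (s≤s z≤n))
  ... | x , bx≥1 , before-x = x , (lo≤x , bx≥1) , (d≤1 , |d|≡k , d≡0)
    where
    lo≤x : lo ≤ toℕ x
    lo≤x with lo ≤? toℕ x
    ... | yes lo≤ = lo≤
    ... | no lo≰  = ⊥-elim (NP.<⇒≱ bx≥1 (NP.≤-reflexive (b≡0 x (NP.≰⇒> lo≰))))
    d≤1 : ∀ i → decrement x b i ≤ 1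
    d≤1 i = NP.≤-trans (NP.m∸n≤m (b i) (unitVec x i)) (b≤1 i)
    |d|≡k : size (decrement x b) ≡ k
    |d|≡k = NP.suc-injective (≡.trans (≡.sym (size-decrement x b bx≥1)) |b|≡)
    d≡0 : ∀ i → toℕ i < suc (toℕ x) → decrement x b i ≡ 0
    d≡0 i i≤x with i Fin.≟ x
    ... | yes ≡.refl = ≡.trans (decrement-at x b) (NP.m≤n⇒m∸n≡0 (b≤1 x))
    ... | no i≢x     = ≡.trans (decrement-elsewhere x i b i≢x)
                         (before-x i (NP.≤∧≢⇒< (NP.≤-pred i≤x) (λ i≡x → i≢x (FinP.toℕ-injective i≡x))))

module Proof {c′ ℓ′} (R : CommutativeRing c′ ℓ′) where
  open CommutativeRing R hiding (zero)
  open Series R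
  open import Relation.Binary.Reasoning.Setoid setoid
  open import Algebra.Properties.Ring ring using (-0#≈0#; -‿+-comm; -1*x≈-x; x[y-z]≈xy-xz)
  open import Algebra.Properties.CommutativeSemigroup +-commutativeSemigroup using () renaming (interchange to +-interchange)

  ∑ : ∀ {a} {A : Set a} → (A → Carrier) → List A → Carrier
  ∑ f xs = Σ (map f xs)

  ∑-++ : ∀ {a} {A : Set a} (f : A → Carrier) xs ys → ∑ f (xs ++ ys) ≈ ∑ f xs + ∑ f ys
  ∑-++ f []       ys = sym (+-identityˡ _)
  ∑-++ f (x ∷ xs) ys = trans (+-congˡ (∑-++ f xs ys)) (sym (+-assoc _ _ _))

  ∑-map : ∀ {a b} {A : Set a} {B : Set b} (f : B → Carrier) (h : A → B) xs → ∑ f (map h xs) ≈ ∑ (f ∘ h) xs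
  ∑-map f h []       = refl
  ∑-map f h (x ∷ xs) = +-congˡ (∑-map f h xs)

  ∑-concatMap : ∀ {a b} {A : Set a} {B : Set b} (f : B → Carrier) (h : A → List B) xs →
    ∑ f (concatMap h xs) ≈ ∑ (λ x → ∑ f (h x)) xs
  ∑-concatMap f h []       = refl
  ∑-concatMap f h (x ∷ xs) = trans (∑-++ f (h x) (concat (map h xs))) (+-congˡ (∑-concatMap f h xs))

  ∑-cong : ∀ {a} {A : Set a} {f g : A → Carrier} xs → (∀ x → f x ≈ g x) → ∑ f xs ≈ ∑ g xs
  ∑-cong []       f≈g = refl
  ∑-cong (x ∷ xs) f≈g = +-cong (f≈g x) (∑-cong xs f≈g)

  ∑-+ : ∀ {a} {A : Set a} (f g : A → Carrier) xs → ∑ (λ x → f x + g x) xs ≈ ∑ f xs + ∑ g xs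
  ∑-+ f g []       = sym (+-identityˡ _)
  ∑-+ f g (x ∷ xs) = trans (+-congˡ (∑-+ f g xs)) (+-interchange (f x) (g x) (∑ f xs) (∑ g xs))

  ∑-0 : ∀ {a} {A : Set a} (f : A → Carrier) xs → (∀ x → f x ≈ 0#) → ∑ f xs ≈ 0#
  ∑-0 f []       f≈0 = refl
  ∑-0 f (x ∷ xs) f≈0 = trans (+-cong (f≈0 x) (∑-0 f xs f≈0)) (+-identityˡ _)

  ∑-*ˡ : ∀ {a} {A : Set a} (k : Carrier) (f : A → Carrier) xs → k * ∑ f xs ≈ ∑ (λ x → k * f x) xs
  ∑-*ˡ k f []       = zeroʳ k
  ∑-*ˡ k f (x ∷ xs) = trans (distribˡ _ _ _) (+-congˡ (∑-*ˡ k f xs))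

  ∑-*ʳ : ∀ {a} {A : Set a} (k : Carrier) (f : A → Carrier) xs → ∑ f xs * k ≈ ∑ (λ x → f x * k) xs
  ∑-*ʳ k f xs = trans (*-comm _ _) (trans (∑-*ˡ k f xs) (∑-cong xs (λ x → *-comm _ _)))

  ∑-swap : ∀ {a b} {A : Set a} {B : Set b} (f : A → B → Carrier) xs ys →
    ∑ (λ x → ∑ (λ y → f x y) ys) xs ≈ ∑ (λ y → ∑ (λ x → f x y) xs) ys
  ∑-swap f []       ys = sym (∑-0 _ ys (λ _ → refl))
  ∑-swap f (x ∷ xs) ys = trans (+-congˡ (∑-swap f xs ys)) (sym (∑-+ (f x) (λ y → ∑ (λ x → f x y) xs) ys))

  ∑-neg : ∀ {a} {A : Set a} (f : A → Carrier) xs → ∑ (λ x → - f x) xs ≈ - ∑ f xs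
  ∑-neg f []       = sym -0#≈0#
  ∑-neg f (x ∷ xs) = trans (+-congˡ (∑-neg f xs)) (-‿+-comm _ _)

  ∑-- : ∀ {a} {A : Set a} (f g : A → Carrier) xs → ∑ (λ x → f x - g x) xs ≈ ∑ f xs - ∑ g xs
  ∑-- f g xs = trans (∑-+ f (λ x → - g x) xs) (+-congˡ (∑-neg g xs))

  ⟦_⟧ : ∀ {p} {Q : Set p} → Dec Q → Carrier
  ⟦ d ⟧ = if does d then 1# else 0#

  ⟦⟧-yes : ∀ {p} {Q : Set p} (d : Dec Q) → Q → ⟦ d ⟧ ≈ 1#
  ⟦⟧-yes d q = reflexive (if-yes d q)

  ⟦⟧-no : ∀ {p} {Q : Set p} (d : Dec Q) → ¬ Q → ⟦ d ⟧ ≈ 0#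
  ⟦⟧-no d ¬q = reflexive (if-no d ¬q)

  ⟦⟧-iff : ∀ {p q} {Q : Set p} {Q' : Set q} (d : Dec Q) (d' : Dec Q') → (Q → Q') → (Q' → Q) → ⟦ d ⟧ ≈ ⟦ d' ⟧
  ⟦⟧-iff (yes q) d' to from = sym (⟦⟧-yes d' (to q))
  ⟦⟧-iff (no ¬q) d' to from = sym (⟦⟧-no d' (¬q ∘ from))

  ⟦⟧-× : ∀ {p q s} {Q : Set p} {Q₁ : Set q} {Q₂ : Set s} (d : Dec Q) (d₁ : Dec Q₁) (d₂ : Dec Q₂) →
    (Q → Q₁ × Q₂) → (Q₁ → Q₂ → Q) → ⟦ d ⟧ ≈ ⟦ d₁ ⟧ * ⟦ d₂ ⟧
  ⟦⟧-× d (yes q₁) (yes q₂) to from = trans (⟦⟧-yes d (from q₁ q₂)) (sym (*-identityˡ _))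
  ⟦⟧-× d (yes q₁) (no ¬q₂) to from = trans (⟦⟧-no d (¬q₂ ∘ proj₂ ∘ to)) (sym (zeroʳ _))
  ⟦⟧-× d (no ¬q₁) d₂       to from = trans (⟦⟧-no d (¬q₁ ∘ proj₁ ∘ to)) (sym (zeroˡ _))

  ⟦⟧-guard : ∀ {p} {Q : Set p} (d : Dec Q) {x y : Carrier} → (Q → x ≈ y) → ⟦ d ⟧ * x ≈ ⟦ d ⟧ * y
  ⟦⟧-guard (yes q) x≈y = *-congˡ (x≈y q)
  ⟦⟧-guard (no _)  x≈y = trans (zeroˡ _) (sym (zeroˡ _))

  ∑-filter : ∀ {a p} {A : Set a} {Q : A → Set p} (Q? : ∀ x → Dec (Q x)) (f : A → Carrier) xs →
    ∑ f (filter Q? xs) ≈ ∑ (λ x → ⟦ Q? x ⟧ * f x) xs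
  ∑-filter Q? f []       = refl
  ∑-filter Q? f (x ∷ xs) with Q? x
  ... | yes _ = +-cong (sym (*-identityˡ _)) (∑-filter Q? f xs)
  ... | no _  = trans (∑-filter Q? f xs) (sym (trans (+-congʳ (zeroˡ _)) (+-identityˡ _)))

  ∑-range-suc : (f : ℕ → Carrier) → ∀ s N → ∑ f (range s (suc N)) ≈ ∑ f (range s N) + f (s +ℕ N)
  ∑-range-suc f s zero    = trans (+-comm _ _) (+-congˡ (reflexive (≡.cong f (≡.sym (NP.+-identityʳ s)))))
  ∑-range-suc f s (suc N) = trans (+-congˡ (∑-range-suc f (suc s) N))
    (trans (sym (+-assoc _ _ _)) (+-congˡ (reflexive (≡.cong f (≡.sym (NP.+-suc s N))))))

  ∑-range-+ : (f : ℕ → Carrier) → ∀ s N M → ∑ f (range s (N +ℕ M)) ≈ ∑ f (range s N) + ∑ f (range (s +ℕ N) M)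
  ∑-range-+ f s zero    M = trans (reflexive (≡.cong (λ z → ∑ f (range z M)) (≡.sym (NP.+-identityʳ s))))
                                  (sym (+-identityˡ _))
  ∑-range-+ f s (suc N) M = trans (+-congˡ (trans (∑-range-+ f (suc s) N M)
      (+-congˡ (reflexive (≡.cong (λ z → ∑ f (range z M)) (≡.sym (NP.+-suc s N)))))))
    (sym (+-assoc _ _ _))

  ∑-range-cong : {f g : ℕ → Carrier} → ∀ s N → (∀ i → s ≤ i → i < s +ℕ N → f i ≈ g i) →
    ∑ f (range s N) ≈ ∑ g (range s N)
  ∑-range-cong s zero    f≈g = refl
  ∑-range-cong s (suc N) f≈g = +-cong (f≈g s NP.≤-refl (NP.m<m+n s (s≤s z≤n)))
    (∑-range-cong (suc s) N (λ i s<i i< → f≈g i (NP.<⇒≤ s<i) (≡.subst (i <_) (≡.sym (NP.+-suc s N)) i<)))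

  ∑-range-0 : (f : ℕ → Carrier) → ∀ s N → (∀ i → s ≤ i → i < s +ℕ N → f i ≈ 0#) → ∑ f (range s N) ≈ 0#
  ∑-range-0 f s N f≈0 = trans (∑-range-cong s N f≈0) (∑-0 _ (range s N) (λ _ → refl))

  ∑-range-δ-below : (h : ℕ → Carrier) → ∀ z s N → z < s → ∑ (λ i → ⟦ z ≟ i ⟧ * h i) (range s N) ≈ 0#
  ∑-range-δ-below h z s N z<s = ∑-range-0 _ s N
    (λ i s≤i _ → trans (*-congʳ (⟦⟧-no (z ≟ i) (λ z≡i → NP.<⇒≱ z<s (≡.subst (s ≤_) (≡.sym z≡i) s≤i)))) (zeroˡ _))

  ∑-range-δ : (h : ℕ → Carrier) → ∀ z s N → s ≤ z → z < s +ℕ N → ∑ (λ i → ⟦ z ≟ i ⟧ * h i) (range s N) ≈ h z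
  ∑-range-δ h z s zero    s≤z z< = ⊥-elim (NP.<⇒≱ z< (≡.subst (_≤ z) (≡.sym (NP.+-identityʳ s)) s≤z))
  ∑-range-δ h z s (suc N) s≤z z< with z ≟ s
  ... | yes ≡.refl = trans (+-cong (trans (*-congʳ (⟦⟧-yes (z ≟ z) ≡.refl)) (*-identityˡ _))
                                   (∑-range-δ-below h z (suc s) N NP.≤-refl))
                           (+-identityʳ _)
  ... | no z≢s = trans (+-congʳ (trans (*-congʳ (⟦⟧-no (z ≟ s) z≢s)) (zeroˡ _)))
                   (trans (+-identityˡ _) (∑-range-δ h z (suc s) N (NP.≤∧≢⇒< s≤z (z≢s ∘ ≡.sym))
                                                    (≡.subst (z <_) (NP.+-suc s N) z<)))

  ∑-allFin-suc : ∀ {n} (f : Fin (suc n) → Carrier) → ∑ f (allFin (suc n)) ≈ f Fin.zero + ∑ (f ∘ Fin.suc) (allFin n)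
  ∑-allFin-suc {n} f = reflexive (≡.cong Σ (allFin-suc n f))

  ∑-allFin-δ : ∀ {n} (h : Fin n → Carrier) z → ∑ (λ x → ⟦ x Fin.≟ z ⟧ * h x) (allFin n) ≈ h z
  ∑-allFin-δ {suc n} h Fin.zero = trans (∑-allFin-suc {n} _)
    (trans (+-cong (trans (*-congʳ (⟦⟧-yes (Fin.zero {n} Fin.≟ Fin.zero) ≡.refl)) (*-identityˡ _))
                   (∑-0 _ (allFin n) (λ x → trans (*-congʳ (⟦⟧-no (Fin.suc x Fin.≟ Fin.zero) (λ ()))) (zeroˡ _))))
     (+-identityʳ _))
  ∑-allFin-δ {suc n} h (Fin.suc z) = trans (∑-allFin-suc {n} _)
    (trans (+-cong (trans (*-congʳ (⟦⟧-no (Fin.zero Fin.≟ Fin.suc z) (λ ()))) (zeroˡ _))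
                   (∑-cong (allFin n) (λ x → *-congʳ (⟦⟧-iff (Fin.suc x Fin.≟ Fin.suc z) (x Fin.≟ z)
                                                              FinP.suc-injective (≡.cong Fin.suc)))))
     (trans (+-identityˡ _) (∑-allFin-δ {n} (h ∘ Fin.suc) z)))

  ∑-allFin-unique : ∀ {n p q} {Q : Fin n → Set p} {Rr : Set q} (Q? : ∀ x → Dec (Q x)) (R? : Dec Rr) →
    (∀ x → Q x → Rr) → (Rr → ∃ Q) → (∀ x y → Q x → Q y → x ≡ y) →
    ∑ (λ x → ⟦ Q? x ⟧) (allFin n) ≈ ⟦ R? ⟧
  ∑-allFin-unique {n} Q? (no ¬r) Q⇒R R⇒Q unique = ∑-0 _ (allFin n) (λ x → ⟦⟧-no (Q? x) (¬r ∘ Q⇒R x))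
  ∑-allFin-unique {n} Q? (yes r) Q⇒R R⇒Q unique with R⇒Q r
  ... | x₀ , qx₀ = trans (∑-cong (allFin n) (λ x → trans
                            (⟦⟧-iff (Q? x) (x Fin.≟ x₀) (λ qx → unique x x₀ qx qx₀) (λ x≡x₀ → ≡.subst _ (≡.sym x≡x₀) qx₀))
                            (sym (*-identityʳ _))))
                         (∑-allFin-δ {n} (λ _ → 1#) x₀)

  ∑-words-suc : ∀ {n} L (f : List (Fin n) → Carrier) →
    ∑ f (allWords n (suc L)) ≈ ∑ (λ x → ∑ (λ v → f (x ∷ v)) (allWords n L)) (allFin n)
  ∑-words-suc {n} L f = trans (∑-concatMap f (λ a → map (a ∷_) (allWords n L)) (allFin n))
    (∑-cong (allFin n) (λ x → ∑-map f (x ∷_) (allWords n L)))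

  ∑-words-split : ∀ {n} k j (f : List (Fin n) → Carrier) →
    ∑ f (allWords n (k +ℕ j)) ≈ ∑ (λ u → ∑ (λ w → f (u ++ w)) (allWords n j)) (allWords n k)
  ∑-words-split {n} zero    j f = sym (+-identityʳ _)
  ∑-words-split {n} (suc k) j f = begin
    ∑ f (allWords n (suc (k +ℕ j)))                                                     ≈⟨ ∑-words-suc (k +ℕ j) f ⟩
    ∑ (λ x → ∑ (λ v → f (x ∷ v)) (allWords n (k +ℕ j))) (allFin n)
      ≈⟨ ∑-cong (allFin n) (λ x → ∑-words-split k j (λ v → f (x ∷ v))) ⟩
    ∑ (λ x → ∑ (λ u → ∑ (λ w → f (x ∷ u ++ w)) (allWords n j)) (allWords n k)) (allFin n)
      ≈⟨ ∑-words-suc {n} k (λ u → ∑ (λ w → f (u ++ w)) (allWords n j)) ⟨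
    ∑ (λ u → ∑ (λ w → f (u ++ w)) (allWords n j)) (allWords n (suc k)) ∎

  ∑-words-cong : ∀ {n} L {f g : List (Fin n) → Carrier} → (∀ v → length v ≡ L → f v ≈ g v) →
    ∑ f (allWords n L) ≈ ∑ g (allWords n L)
  ∑-words-cong {n} zero    f≈g = +-cong (f≈g [] ≡.refl) refl
  ∑-words-cong {n} (suc L) {f} {g} f≈g = trans (∑-words-suc L f)
    (trans (∑-cong (allFin n) (λ x → ∑-words-cong L (λ v |v|≡ → f≈g (x ∷ v) (≡.cong suc |v|≡))))
           (sym (∑-words-suc L g)))

  ∑-box-suc : ∀ {n} (m : Fin (suc n) → ℕ) (f : (Fin (suc n) → ℕ) → Carrier) →
    ∑ f (box (suc n) m) ≈ ∑ (λ i → ∑ (λ a → f (i ∷ᶠ a)) (box n (tail m))) (range 0 (suc (m Fin.zero)))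
  ∑-box-suc {n} m f = trans (∑-concatMap f (λ i → map (i ∷ᶠ_) (box n (tail m))) (upTo (suc (head m))))
    (trans (∑-cong (upTo (suc (head m))) (λ i → ∑-map f (i ∷ᶠ_) (box n (tail m))))
      (reflexive (≡.cong (∑ (λ i → ∑ (λ a → f (i ∷ᶠ a)) (box n (tail m))))
                         (applyUpTo≡range 0 (suc (m Fin.zero)) (λ i → ≡.refl)))))

  ∑-box-cong : ∀ {n} (m : Fin n → ℕ) {f g : (Fin n → ℕ) → Carrier} → (∀ a → (∀ i → a i ≤ m i) → f a ≈ g a) →
    ∑ f (box n m) ≈ ∑ g (box n m)
  ∑-box-cong {zero}  m f≈g = +-cong (f≈g _ (λ ())) refl
  ∑-box-cong {suc n} m {f} {g} f≈g = trans (∑-box-suc m f) (trans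
    (∑-range-cong 0 (suc (m Fin.zero)) (λ i _ i≤ → ∑-box-cong (tail m) (λ a a≤ → f≈g (i ∷ᶠ a) (cons≤ i a i≤ a≤))))
    (sym (∑-box-suc m g)))
    where
    cons≤ : ∀ i a → i < suc (m Fin.zero) → (∀ j → a j ≤ tail m j) → ∀ j → (i ∷ᶠ a) j ≤ m j
    cons≤ i a (s≤s i≤) a≤ Fin.zero    = i≤
    cons≤ i a _        a≤ (Fin.suc j) = a≤ j

  ∑-box-δ : ∀ {n} (m z : Fin n → ℕ) → (∀ i → z i ≤ m i) → ∑ (λ a → ⟦ z ≗? a ⟧) (box n m) ≈ 1#
  ∑-box-δ {zero}  m z z≤m = trans (+-identityʳ _) (⟦⟧-yes (z ≗? (λ ())) (λ ()))
  ∑-box-δ {suc n} m z z≤m = begin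
    ∑ (λ a → ⟦ z ≗? a ⟧) (box (suc n) m)                                     ≈⟨ ∑-box-suc m _ ⟩
    ∑ (λ i → ∑ (λ a → ⟦ z ≗? (i ∷ᶠ a) ⟧) (box n (tail m))) (range 0 (suc (m Fin.zero)))
      ≈⟨ ∑-range-cong 0 (suc (m Fin.zero)) (λ i _ _ → ∑-cong (box n (tail m)) (λ a →
            ⟦⟧-× (z ≗? (i ∷ᶠ a)) (z Fin.zero ≟ i) (tail z ≗? a)
              (λ z≗ → z≗ Fin.zero , (λ j → z≗ (Fin.suc j)))
              (λ z₀≡i tail≗ → λ { Fin.zero → z₀≡i ; (Fin.suc j) → tail≗ j }))) ⟩
    ∑ (λ i → ∑ (λ a → ⟦ z Fin.zero ≟ i ⟧ * ⟦ tail z ≗? a ⟧) (box n (tail m))) (range 0 (suc (m Fin.zero)))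
      ≈⟨ ∑-range-cong 0 (suc (m Fin.zero)) (λ i _ _ → trans (sym (∑-*ˡ _ _ (box n (tail m))))
            (*-congˡ (∑-box-δ (tail m) (tail z) (z≤m ∘ Fin.suc)))) ⟩
    ∑ (λ i → ⟦ z Fin.zero ≟ i ⟧ * 1#) (range 0 (suc (m Fin.zero)))
      ≈⟨ ∑-range-δ (λ _ → 1#) (z Fin.zero) 0 (suc (m Fin.zero)) z≤n (s≤s (z≤m Fin.zero)) ⟩
    1# ∎

  ⊛-congʳ : ∀ {n} (f h h' : FPS n) → (∀ b → h b ≈ h' b) → ∀ m → (f ⊛ h) m ≈ (f ⊛ h') m
  ⊛-congʳ {n} f h h' h≈h' m = ∑-cong (box n m) (λ a → *-congˡ (h≈h' _))

  ⊛-1- : ∀ {n} (f h : FPS n) m → (f ⊛ (𝟙 ⊕ (⊖ h))) m ≈ (f ⊛ 𝟙) m - (f ⊛ h) m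
  ⊛-1- {n} f h m = trans (∑-cong (box n m) (λ a → x[y-z]≈xy-xz _ _ _))
                         (∑-- (λ a → f a * 𝟙 (λ i → m i ∸ a i)) (λ a → f a * h (λ i → m i ∸ a i)) (box n m))

  ⊛-identityʳ : ∀ {n} (f : FPS n) → (∀ a b → (∀ i → a i ≡ b i) → f a ≈ f b) → ∀ m → (f ⊛ 𝟙) m ≈ f m
  ⊛-identityʳ {n} f f-cong m = begin
    ∑ (λ a → f a * 𝟙 (λ i → m i ∸ a i)) (box n m)
      ≈⟨ ∑-box-cong m (λ a a≤m → trans (*-comm _ _) (trans
           (*-congʳ (⟦⟧-iff (FinP.all? (λ i → m i ∸ a i ≟ 0)) (m ≗? a)
              (λ m-a≡0 i → NP.≤-antisym (NP.m∸n≡0⇒m≤n (m-a≡0 i)) (a≤m i))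
              (λ m≗a i → ≡.trans (≡.cong (_∸ a i) (m≗a i)) (NP.n∸n≡0 (a i)))))
           (⟦⟧-guard (m ≗? a) (λ m≗a → f-cong a m (λ i → ≡.sym (m≗a i)))))) ⟩
    ∑ (λ a → ⟦ m ≗? a ⟧ * f m) (box n m) ≈⟨ ∑-*ʳ _ _ (box n m) ⟨
    ∑ (λ a → ⟦ m ≗? a ⟧) (box n m) * f m ≈⟨ *-congʳ (∑-box-δ m m (λ i → NP.≤-refl)) ⟩
    1# * f m                              ≈⟨ *-identityˡ _ ⟩
    f m ∎

  g-unfold : ∀ n r t (a : Fin n → ℕ) →
    g n r t a ≈ ∑ (λ w → ⟦ (λ i → count i w) ≗? a ⟧ * pow t (α r w)) (allWords n (size a))
  g-unfold n r t a = ∑-filter (λ w → (λ i → count i w) ≗? a) (λ w → pow t (α r w)) (allWords n (size a))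

  g-cong : ∀ n r t (a b : Fin n → ℕ) → (∀ i → a i ≡ b i) → g n r t a ≈ g n r t b
  g-cong n r t a b a≗b = begin
    g n r t a ≈⟨ g-unfold n r t a ⟩
    ∑ (λ w → ⟦ (λ i → count i w) ≗? a ⟧ * pow t (α r w)) (allWords n (size a))
      ≡⟨ ≡.cong (λ L → ∑ (λ w → ⟦ (λ i → count i w) ≗? a ⟧ * pow t (α r w)) (allWords n L)) (size-cong a≗b) ⟩
    ∑ (λ w → ⟦ (λ i → count i w) ≗? a ⟧ * pow t (α r w)) (allWords n (size b))
      ≈⟨ ∑-cong (allWords n (size b)) (λ w → *-congʳ (⟦⟧-iff ((λ i → count i w) ≗? a) ((λ i → count i w) ≗? b)
            (λ w≗a i → ≡.trans (w≗a i) (a≗b i)) (λ w≗b i → ≡.trans (w≗b i) (≡.sym (a≗b i))))) ⟩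
    ∑ (λ w → ⟦ (λ i → count i w) ≗? b ⟧ * pow t (α r w)) (allWords n (size b)) ≈⟨ g-unfold n r t b ⟨
    g n r t b ∎

  -- Only the empty word has content 0, and it has no occurrence of 12⋯r (r ≥ 1).
  g-empty : ∀ n r t (m : Fin n → ℕ) → 1 ≤ r → (∀ i → m i ≡ 0) → g n r t m ≈ 1#
  g-empty n (suc r) t m _ m≡0 = begin
    g n (suc r) t m ≈⟨ g-unfold n (suc r) t m ⟩
    ∑ (λ w → ⟦ (λ i → count i w) ≗? m ⟧ * pow t (α (suc r) w)) (allWords n (size m))
      ≡⟨ ≡.cong (λ L → ∑ (λ w → ⟦ (λ i → count i w) ≗? m ⟧ * pow t (α (suc r) w)) (allWords n L)) (size-zero m m≡0) ⟩
    ⟦ (λ i → count i []) ≗? m ⟧ * 1# + 0# ≈⟨ +-identityʳ _ ⟩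
    ⟦ (λ i → count i []) ≗? m ⟧ * 1#      ≈⟨ *-congʳ (⟦⟧-yes ((λ i → count i []) ≗? m) (≡.sym ∘ m≡0)) ⟩
    1# * 1#                               ≈⟨ *-identityˡ _ ⟩
    1# ∎

  pow-+ : ∀ x a b → pow x (a +ℕ b) ≈ pow x a * pow x b
  pow-+ x zero    b = sym (*-identityˡ _)
  pow-+ x (suc a) b = trans (*-congˡ (pow-+ x a b)) (sym (*-assoc _ _ _))

  -- Counting increasing words

  -- Induction on k: the first letter is forced to be the minimum of the set.
  increasing-count : ∀ {n} k lo (b : Fin n → ℕ) →
    ∑ (λ u → ⟦ increasingWord? lo b u ⟧) (allWords n k) ≈ ⟦ indicator? lo b k ⟧
  increasing-count {n} zero lo b = trans (+-identityʳ _) (⟦⟧-iff (increasingWord? lo b []) (indicator? lo b 0) to from)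
    where
    to : IncreasingWord lo b [] → Indicator lo b 0
    to (_ , _ , b≡0) = (λ i → ≡.subst (_≤ 1) (b≡0 i) z≤n) , size-zero b (≡.sym ∘ b≡0) , (λ i _ → ≡.sym (b≡0 i))
    from : Indicator lo b 0 → IncreasingWord lo b []
    from (_ , |b|≡0 , _) = Linked.[] , All.[] , (λ i → ≡.sym (size-zero⁻ b |b|≡0 i))
  increasing-count {n} (suc k) lo b = begin
    ∑ (λ u → ⟦ increasingWord? lo b u ⟧) (allWords n (suc k))
      ≈⟨ ∑-words-suc {n} k (λ u → ⟦ increasingWord? lo b u ⟧) ⟩
    ∑ (λ x → ∑ (λ u → ⟦ increasingWord? lo b (x ∷ u) ⟧) (allWords n k)) (allFin n)
      ≈⟨ ∑-cong (allFin n) (λ x → ∑-cong (allWords n k) (λ u →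
           ⟦⟧-× (increasingWord? lo b (x ∷ u)) (admissible? lo b x) (increasingWord? (suc (toℕ x)) (decrement x b) u)
                (increasing-cons⇒ lo b x u) (increasing-cons⇐ lo b x u))) ⟩
    ∑ (λ x → ∑ (λ u → ⟦ admissible? lo b x ⟧ * ⟦ increasingWord? (suc (toℕ x)) (decrement x b) u ⟧) (allWords n k)) (allFin n)
      ≈⟨ ∑-cong (allFin n) (λ x → trans (sym (∑-*ˡ _ _ (allWords n k)))
                                        (*-congˡ (increasing-count k (suc (toℕ x)) (decrement x b)))) ⟩
    ∑ (λ x → ⟦ admissible? lo b x ⟧ * ⟦ indicator? (suc (toℕ x)) (decrement x b) k ⟧) (allFin n)
      ≈⟨ ∑-cong (allFin n) (λ x → sym (⟦⟧-× (firstLetter? lo b k x) (admissible? lo b x)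
                                            (indicator? (suc (toℕ x)) (decrement x b) k) id _,_)) ⟩
    ∑ (λ x → ⟦ firstLetter? lo b k x ⟧) (allFin n)
      ≈⟨ ∑-allFin-unique (firstLetter? lo b k) (indicator? lo b (suc k))
           (firstLetter⇒indicator lo b k) (firstLetter-exists lo b k) (firstLetter-unique lo b k) ⟩
    ⟦ indicator? lo b (suc k) ⟧ ∎

  P-lt : ∀ r t k → suc k < r → P r t (suc k) ≡ 0#
  P-lt r t k k<r = if-yes (suc k <? r) k<r

  P-eq : ∀ r t k → suc k ≡ r → P r t (suc k) ≡ t - 1#
  P-eq r t k k≡r = ≡.trans (if-no (suc k <? r) (NP.<-irrefl k≡r)) (if-yes (suc k ≟ r) k≡r)

  P-gt : ∀ r t k → r < suc k → P r t (suc k) ≡ (t - 1#) * Σ (take (r ∸ 1) (Ps r t k))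
  P-gt r t k r<k = ≡.trans (if-no (suc k <? r) (NP.<-asym r<k)) (if-no (suc k ≟ r) (λ k≡r → NP.<-irrefl (≡.sym k≡r) r<k))

  take-Ps : ∀ r t j k → j ≤ k → Σ (take j (Ps r t k)) ≈ ∑ (P r t) (range (suc (k ∸ j)) j)
  take-Ps r t zero    k       _       = refl
  take-Ps r t (suc j) (suc k) (s≤s j≤k) = begin
    P r t (suc k) + Σ (take j (Ps r t k))                         ≈⟨ +-congˡ (take-Ps r t j k j≤k) ⟩
    P r t (suc k) + ∑ (P r t) (range (suc (k ∸ j)) j)             ≈⟨ +-comm _ _ ⟩
    ∑ (P r t) (range (suc (k ∸ j)) j) + P r t (suc k)
      ≡⟨ ≡.cong (λ i → ∑ (P r t) (range (suc (k ∸ j)) j) + P r t i) (≡.cong suc (NP.m∸n+n≡m j≤k)) ⟨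
    ∑ (P r t) (range (suc (k ∸ j)) j) + P r t (suc (k ∸ j) +ℕ j)  ≈⟨ ∑-range-suc (P r t) (suc (k ∸ j)) j ⟨
    ∑ (P r t) (range (suc (k ∸ j)) (suc j)) ∎

  module Pattern (r' : ℕ) (t : Carrier) where

    -- ρ = r - 1 ≥ 1 is the length of the window in the recursion of P.
    ρ : ℕ
    ρ = suc r'

    r : ℕ
    r = suc ρ

    -- c_1 = 1 and c_k = P_k for k ≥ 2: the coefficient of e_k in 1 - D.
    c : ℕ → Carrier
    c zero          = 0#
    c (suc zero)    = 1#
    c (suc (suc k)) = P r t (suc (suc k))

    c-P : ∀ k → 2 ≤ k → c k ≡ P r t k
    c-P (suc zero)    (s≤s ())
    c-P (suc (suc k)) _ = ≡.refl

    c-below-r : ∀ k → 2 ≤ k → k < r → c k ≈ 0#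
    c-below-r (suc zero)    (s≤s ()) _
    c-below-r (suc (suc k)) _ k<r = reflexive (P-lt r t (suc k) k<r)

    ∑c-initial : ∀ ℓ → 1 ≤ ℓ → ℓ ≤ ρ → ∑ c (range 1 ℓ) ≈ 1#
    ∑c-initial (suc ℓ) _ ℓ≤ρ = trans (+-congˡ (∑-range-0 c 2 ℓ (λ i 2≤i i< → c-below-r i 2≤i (NP.<-≤-trans i< (s≤s ℓ≤ρ)))))
                                     (+-identityʳ _)

    window : ℕ → Carrier
    window q = ∑ c (range (suc q) ρ)

    -- c_{q+r} = (t - 1) · window q: for q = 0 because c_r = t - 1 and
    -- window 0 = 1, for q > 0 by the recursion defining P.
    c-recursion : ∀ q → c (q +ℕ r) ≈ (t - 1#) * window q
    c-recursion zero = trans (reflexive (P-eq r t ρ ≡.refl))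
                             (trans (sym (*-identityʳ _)) (*-congˡ (sym (∑c-initial ρ (s≤s z≤n) NP.≤-refl))))
    c-recursion (suc q) = begin
      c (suc (q +ℕ r))                                           ≡⟨ c-P (suc (q +ℕ r)) (s≤s (NP.≤-trans (s≤s z≤n) (NP.m≤n+m r q))) ⟩
      P r t (suc (q +ℕ r))                                       ≡⟨ P-gt r t (q +ℕ r) (s≤s (NP.m≤n+m r q)) ⟩
      (t - 1#) * Σ (take ρ (Ps r t (q +ℕ r)))                     ≈⟨ *-congˡ (take-Ps r t ρ (q +ℕ r) ρ≤) ⟩
      (t - 1#) * ∑ (P r t) (range (suc ((q +ℕ r) ∸ ρ)) ρ)        ≡⟨ ≡.cong (λ z → (t - 1#) * ∑ (P r t) (range (suc z) ρ)) q+r-ρ≡ ⟩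
      (t - 1#) * ∑ (P r t) (range (suc (suc q)) ρ)               ≈⟨ *-congˡ (∑-range-cong (suc (suc q)) ρ
                                                                      (λ i 2≤i _ → reflexive (≡.sym (c-P i (NP.≤-trans (s≤s (s≤s z≤n)) 2≤i))))) ⟩
      (t - 1#) * window (suc q) ∎
      where
      ρ≤ : ρ ≤ q +ℕ r
      ρ≤ = NP.≤-trans (NP.n≤1+n ρ) (NP.m≤n+m r q)
      q+r-ρ≡ : (q +ℕ r) ∸ ρ ≡ suc q
      q+r-ρ≡ = ≡.trans (≡.cong (_∸ ρ) (NP.+-suc q ρ)) (NP.m+n∸n≡m (suc q) ρ)

    H : ℕ → Carrier
    H q = ∑ (λ k → c k * pow t (q ∸ k)) (range 1 q)

    H-suc : ∀ q → H (suc q) ≈ t * H q + c (suc q)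
    H-suc q = trans (∑-range-suc _ 1 q) (+-cong
      (trans (∑-range-cong 1 q (λ i _ i≤q → trans (*-congˡ (reflexive (≡.cong (pow t) (NP.+-∸-assoc 1 (NP.≤-pred i≤q)))))
                                                   (*-comm-middle i)))
             (sym (∑-*ˡ t _ (range 1 q))))
      (trans (*-congˡ (reflexive (≡.cong (pow t) (NP.n∸n≡0 q)))) (*-identityʳ _)))
      where
      *-comm-middle : ∀ i → c i * (t * pow t (q ∸ i)) ≈ t * (c i * pow t (q ∸ i))
      *-comm-middle i = trans (sym (*-assoc _ _ _)) (trans (*-congʳ (*-comm _ _)) (*-assoc _ _ _))

    ∑ct-split : ∀ q → ∑ (λ k → c k * pow t (q ∸ k)) (range 1 (q +ℕ ρ)) ≈ H q + window q
    ∑ct-split q = trans (∑-range-+ _ 1 q ρ) (+-congˡ (∑-range-cong (suc q) ρ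
      (λ i q<i _ → trans (*-congˡ (reflexive (≡.cong (pow t) (NP.m≤n⇒m∸n≡0 (NP.<⇒≤ q<i))))) (*-identityʳ _))))

    ∑ct≈pow : ∀ q → ∑ (λ k → c k * pow t (q ∸ k)) (range 1 (q +ℕ ρ)) ≈ pow t q
    ∑ct≈pow zero    = trans (∑ct-split zero) (trans (+-identityˡ _) (∑c-initial ρ (s≤s z≤n) NP.≤-refl))
    ∑ct≈pow (suc q) = begin
      ∑ (λ k → c k * pow t (suc q ∸ k)) (range 1 (suc q +ℕ ρ)) ≈⟨ ∑ct-split (suc q) ⟩
      H (suc q) + window (suc q)                        ≈⟨ +-congʳ (H-suc q) ⟩
      (t * H q + c (suc q)) + window (suc q)            ≈⟨ +-assoc _ _ _ ⟩
      t * H q + ∑ c (range (suc q) (suc ρ))             ≈⟨ +-congˡ (∑-range-suc c (suc q) ρ) ⟩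
      t * H q + (window q + c (suc q +ℕ ρ))             ≡⟨ ≡.cong (λ i → t * H q + (window q + c i)) (≡.sym (NP.+-suc q ρ)) ⟩
      t * H q + (window q + c (q +ℕ r))                 ≈⟨ +-congˡ (+-congˡ (c-recursion q)) ⟩
      t * H q + (window q + (t - 1#) * window q)        ≈⟨ +-congˡ (x+[t-1]x≈tx (window q)) ⟩
      t * H q + t * window q                            ≈⟨ distribˡ _ _ _ ⟨
      t * (H q + window q)                              ≈⟨ *-congˡ (∑ct-split q) ⟨
      t * ∑ (λ k → c k * pow t (q ∸ k)) (range 1 (q +ℕ ρ)) ≈⟨ *-congˡ (∑ct≈pow q) ⟩
      pow t (suc q) ∎
      where
      x+[t-1]x≈tx : ∀ x → x + (t - 1#) * x ≈ t * x
      x+[t-1]x≈tx x = begin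
        x + (t - 1#) * x         ≈⟨ +-congˡ (trans (distribʳ _ _ _) (+-congˡ (-1*x≈-x x))) ⟩
        x + (t * x + - x)        ≈⟨ +-comm _ _ ⟩
        (t * x + - x) + x        ≈⟨ +-assoc _ _ _ ⟩
        t * x + (- x + x)        ≈⟨ +-congˡ (-‿inverseˡ x) ⟩
        t * x + 0#               ≈⟨ +-identityʳ _ ⟩
        t * x ∎

    -- The identity behind the weight expansion: for ℓ ≥ 1,
    -- Σ_{k=1}^{ℓ} c_k t^{(ℓ+1-r-k)⁺} = t^{(ℓ+1-r)⁺}.
    c-identity : ∀ ℓ → 1 ≤ ℓ → ∑ (λ k → c k * pow t ((suc ℓ ∸ r) ∸ k)) (range 1 ℓ) ≈ pow t (suc ℓ ∸ r)
    c-identity ℓ ℓ≥1 with ℓ ≤? ρ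
    ... | yes ℓ≤ρ = begin
      ∑ (λ k → c k * pow t ((ℓ ∸ ρ) ∸ k)) (range 1 ℓ)
        ≈⟨ ∑-cong (range 1 ℓ) (λ k → trans (*-congˡ (reflexive (≡.trans (≡.cong (λ z → pow t (z ∸ k)) ℓ-ρ≡0) (≡.cong (pow t) (NP.0∸n≡0 k)))))
                                           (*-identityʳ _)) ⟩
      ∑ c (range 1 ℓ)        ≈⟨ ∑c-initial ℓ ℓ≥1 ℓ≤ρ ⟩
      1#                     ≡⟨ ≡.cong (pow t) ℓ-ρ≡0 ⟨
      pow t (ℓ ∸ ρ) ∎
      where
      ℓ-ρ≡0 : ℓ ∸ ρ ≡ 0
      ℓ-ρ≡0 = NP.m≤n⇒m∸n≡0 ℓ≤ρ
    ... | no ℓ≰ρ = ≡.subst (λ z → ∑ (λ k → c k * pow t ((ℓ ∸ ρ) ∸ k)) (range 1 z) ≈ pow t (ℓ ∸ ρ))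
                           (NP.m∸n+n≡m (NP.<⇒≤ (NP.≰⇒> ℓ≰ρ))) (∑ct≈pow (ℓ ∸ ρ))

    -- The weight expansion of a word

    term : ∀ {n} → ℕ → List (Fin n) → Carrier
    term k v = ⟦ linked? Fin._<?_ (take k v) ⟧ * (c k * pow t (α r (drop k v)))

    -- For 1 ≤ k ≤ run v the bracket is 1 and α-drop computes the exponent.
    term-inside : ∀ {n} (v : List (Fin n)) k → 1 ≤ k → k ≤ run v →
      pow t (α r (drop (run v) v)) * (c k * pow t ((suc (run v) ∸ r) ∸ k)) ≈ term k v
    term-inside v k k≥1 k≤run = begin
      pow t A * (c k * pow t (q ∸ k))  ≈⟨ trans (sym (*-assoc _ _ _)) (trans (*-congʳ (*-comm _ _)) (*-assoc _ _ _)) ⟩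
      c k * (pow t A * pow t (q ∸ k))  ≈⟨ *-congˡ (pow-+ t A (q ∸ k)) ⟨
      c k * pow t (A +ℕ (q ∸ k))       ≡⟨ ≡.cong (λ z → c k * pow t z) (α-drop r v (s≤s z≤n) (run v ∸ k) k (NP.m+[n∸m]≡n k≤run)) ⟨
      c k * pow t (α r (drop k v))     ≈⟨ *-identityˡ _ ⟨
      1# * (c k * pow t (α r (drop k v)))
        ≈⟨ *-congʳ (⟦⟧-yes (linked? Fin._<?_ (take k v)) (proj₂ (≤run⇒increasing-prefix k v k≥1 k≤run))) ⟨
      term k v ∎
      where
      A q : ℕ
      A = α r (drop (run v) v)
      q = suc (run v) ∸ r

    -- For k > run v the prefix of length k is not increasing.
    term-outside : ∀ {n} (v : List (Fin n)) k → run v < k → k ≤ length v → term k v ≈ 0#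
    term-outside v k run<k k≤|v| = trans (*-congʳ (⟦⟧-no (linked? Fin._<?_ (take k v))
      (λ inc → NP.<⇒≱ run<k (increasing-prefix⇒≤run k v (NP.≤-trans (s≤s z≤n) run<k) k≤|v| inc)))) (zeroˡ _)

    weight-expansion : ∀ {n} (v : List (Fin n)) → 1 ≤ length v → pow t (α r v) ≈ ∑ (λ k → term k v) (range 1 (length v))
    weight-expansion (x ∷ v') _ = begin
      pow t (α r v)                                   ≡⟨ ≡.cong (pow t) (α-drop r v (s≤s z≤n) ℓ 0 ≡.refl) ⟩
      pow t (A +ℕ q)                                  ≈⟨ pow-+ t A q ⟩
      pow t A * pow t q                               ≈⟨ *-congˡ (c-identity ℓ (run-≥1 x v')) ⟨
      pow t A * ∑ (λ k → c k * pow t (q ∸ k)) (range 1 ℓ) ≈⟨ ∑-*ˡ _ _ (range 1 ℓ) ⟩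
      ∑ (λ k → pow t A * (c k * pow t (q ∸ k))) (range 1 ℓ)
        ≈⟨ ∑-range-cong 1 ℓ (λ k k≥1 k< → term-inside v k k≥1 (NP.≤-pred k<)) ⟩
      ∑ (λ k → term k v) (range 1 ℓ)                  ≈⟨ +-identityʳ _ ⟨
      ∑ (λ k → term k v) (range 1 ℓ) + 0#
        ≈⟨ +-congˡ (∑-range-0 (λ k → term k v) (suc ℓ) (|v| ∸ ℓ)
                      (λ k ℓ<k k< → term-outside v k ℓ<k (NP.≤-pred (≡.subst (k <_) (≡.cong suc ℓ+[|v|-ℓ]≡|v|) k<)))) ⟨
      ∑ (λ k → term k v) (range 1 ℓ) + ∑ (λ k → term k v) (range (suc ℓ) (|v| ∸ ℓ))
        ≈⟨ ∑-range-+ (λ k → term k v) 1 ℓ (|v| ∸ ℓ) ⟨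
      ∑ (λ k → term k v) (range 1 (ℓ +ℕ (|v| ∸ ℓ)))   ≡⟨ ≡.cong (λ z → ∑ (λ k → term k v) (range 1 z)) ℓ+[|v|-ℓ]≡|v| ⟩
      ∑ (λ k → term k v) (range 1 |v|) ∎
      where
      v : List (Fin _)
      v = x ∷ v'
      ℓ |v| A q : ℕ
      ℓ = run v
      |v| = length v
      A = α r (drop ℓ v)
      q = suc ℓ ∸ r
      ℓ+[|v|-ℓ]≡|v| : ℓ +ℕ (|v| ∸ ℓ) ≡ |v|
      ℓ+[|v|-ℓ]≡|v| = NP.m+[n∸m]≡n (run-≤-length v)

    -- The coefficient of x^b in e_1 + Σ_{k=r}^{n} P_k e_k: C(b) = [b ∈ {0,1}^n] · c_{|b|}.
    C : ∀ {n} → FPS n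
    C b = ⟦ FinP.all? (λ i → b i ≤? 1) ⟧ * c (size b)

    e-indicator : ∀ {n} k (b : Fin n → ℕ) → (∀ i → b i ≤ 1) → e k b ≡ ⟦ size b ≟ k ⟧
    e-indicator k b b≤1 = if-yes (FinP.all? (λ i → b i ≤? 1)) b≤1

    e-non-indicator : ∀ {n} k (b : Fin n → ℕ) → ¬ (∀ i → b i ≤ 1) → e k b ≡ 0#
    e-non-indicator k b b≰1 = if-no (FinP.all? (λ i → b i ≤? 1)) b≰1

    sumPe-eval : ∀ n (b : Fin n → ℕ) → sumPe n r t b ≡ ∑ (λ k → P r t k * e k b) (range r (suc n ∸ r))
    sumPe-eval n b = ≡.trans (foldr-eval (map (r +ℕ_) (upTo (suc n ∸ r))))
      (≡.cong (∑ (λ k → P r t k * e k b))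
              (≡.trans (LP.map-applyUpTo id (r +ℕ_) (suc n ∸ r)) (applyUpTo≡range r (suc n ∸ r) (λ i → ≡.refl))))
      where
      foldr-eval : ∀ ks → foldr (λ k acc → (P r t k · e k) ⊕ acc) 𝟘 ks b ≡ ∑ (λ k → P r t k * e k b) ks
      foldr-eval []       = ≡.refl
      foldr-eval (k ∷ ks) = ≡.cong (P r t k * e k b +_) (foldr-eval ks)

    indicator-coeff : ∀ n s → s ≤ n → ⟦ s ≟ 1 ⟧ + ∑ (λ k → ⟦ s ≟ k ⟧ * P r t k) (range r (suc n ∸ r)) ≈ c s
    indicator-coeff n s s≤n with r ≤? s
    ... | yes r≤s = trans (+-cong (⟦⟧-no (s ≟ 1) (λ s≡1 → NP.<⇒≱ (s≤s (s≤s z≤n)) (≡.subst (r ≤_) s≡1 r≤s)))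
                                  (∑-range-δ (P r t) s r (suc n ∸ r) r≤s
                                    (≡.subst (s <_) (≡.sym (NP.m+[n∸m]≡n (NP.≤-trans r≤s (NP.≤-trans s≤n (NP.n≤1+n n))))) (s≤s s≤n))))
                          (trans (+-identityˡ _) (reflexive (≡.sym (c-P s (NP.≤-trans (s≤s (s≤s z≤n)) r≤s)))))
    ... | no r≰s = trans (+-congˡ (∑-range-δ-below (P r t) s r (suc n ∸ r) (NP.≰⇒> r≰s)))
                         (trans (+-identityʳ _) (small s (NP.≰⇒> r≰s)))
      where
      small : ∀ s → s < r → ⟦ s ≟ 1 ⟧ ≈ c s
      small zero          _   = refl
      small (suc zero)    _   = refl
      small (suc (suc k)) s<r = sym (c-below-r (suc (suc k)) (s≤s (s≤s z≤n)) s<r)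

    coeff-e₁+∑Pe : ∀ {n} (b : Fin n → ℕ) → e 1 b + sumPe n r t b ≈ C b
    coeff-e₁+∑Pe {n} b with FinP.all? (λ i → b i ≤? 1)
    ... | no b≰1 = begin
      e 1 b + sumPe n r t b                                    ≡⟨ ≡.cong₂ _+_ (e-non-indicator 1 b b≰1) (sumPe-eval n b) ⟩
      0# + ∑ (λ k → P r t k * e k b) (range r (suc n ∸ r))     ≈⟨ +-identityˡ _ ⟩
      ∑ (λ k → P r t k * e k b) (range r (suc n ∸ r))
        ≈⟨ ∑-0 _ (range r (suc n ∸ r)) (λ k → trans (*-congˡ (reflexive (e-non-indicator k b b≰1))) (zeroʳ _)) ⟩
      0#                                                       ≈⟨ zeroˡ _ ⟨
      0# * c (size b)                                          ≈⟨ *-congʳ (⟦⟧-no (FinP.all? (λ i → b i ≤? 1)) b≰1) ⟨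
      C b ∎
    ... | yes b≤1 = begin
      e 1 b + sumPe n r t b                                    ≡⟨ ≡.cong₂ _+_ (e-indicator 1 b b≤1) (sumPe-eval n b) ⟩
      ⟦ size b ≟ 1 ⟧ + ∑ (λ k → P r t k * e k b) (range r (suc n ∸ r))
        ≈⟨ +-congˡ (∑-cong (range r (suc n ∸ r)) (λ k → trans (*-congˡ (reflexive (e-indicator k b b≤1))) (*-comm _ _))) ⟩
      ⟦ size b ≟ 1 ⟧ + ∑ (λ k → ⟦ size b ≟ k ⟧ * P r t k) (range r (suc n ∸ r))
        ≈⟨ indicator-coeff n (size b) (size-01 b b≤1) ⟩
      c (size b)                                               ≈⟨ *-identityˡ _ ⟨
      1# * c (size b)                                          ≈⟨ *-congʳ (⟦⟧-yes (FinP.all? (λ i → b i ≤? 1)) b≤1) ⟨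
      C b ∎

    D≈𝟙-C : ∀ {n} (b : Fin n → ℕ) → D n r t b ≈ (𝟙 ⊕ (⊖ C)) b
    D≈𝟙-C b = +-congˡ (-‿cong (coeff-e₁+∑Pe b))

    -- The recursion g(m) = Σ_{a ≤ m} g(a) · C(m - a) for m ≠ 0

    -- C(0) = c_0 = 0, so the product G · C has no constant term.
    G⊛C-empty : ∀ {n} (m : Fin n → ℕ) → (∀ i → m i ≡ 0) → (G n r t ⊛ C) m ≈ 0#
    G⊛C-empty {n} m m≡0 = ∑-0 _ (box n m) (λ a → trans (*-congˡ (trans (*-congˡ (reflexive
      (≡.cong c (size-zero (λ i → m i ∸ a i) (λ i → ≡.trans (≡.cong (_∸ a i) (m≡0 i)) (NP.0∸n≡0 (a i)))))))
      (zeroʳ _))) (zeroʳ _))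

    module Recursion {n : ℕ} (m : Fin n → ℕ) where

      rest : (Fin n → ℕ) → Fin n → ℕ
      rest a i = m i ∸ a i

      hasContent : (w : List (Fin n)) (a : Fin n → ℕ) → Dec (∀ i → count i w ≡ a i)
      hasContent w a = (λ i → count i w) ≗? a

      gₗ : ℕ → (Fin n → ℕ) → Carrier
      gₗ L a = ∑ (λ w → ⟦ hasContent w a ⟧ * pow t (α r w)) (allWords n L)

      term-++ : ∀ k (u w : List (Fin n)) → length u ≡ k →
        term k (u ++ w) ≡ ⟦ linked? Fin._<?_ u ⟧ * (c k * pow t (α r w))
      term-++ .(length u) u w ≡.refl = ≡.cong₂ (λ x y → ⟦ linked? Fin._<?_ x ⟧ * (c (length u) * pow t (α r y)))
                                                (take-++ u w) (drop-++ u w)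

      -- Inserting the content a of the tail w as a summation index.
      insert-box : ∀ u w (Y : Carrier) →
        ⟦ hasContent (u ++ w) m ⟧ * Y ≈ ∑ (λ a → ⟦ hasContent w a ⟧ * (⟦ hasContent (u ++ w) m ⟧ * Y)) (box n m)
      insert-box u w Y = by-cases (hasContent (u ++ w) m)
        where
        by-cases : Dec (∀ i → count i (u ++ w) ≡ m i) →
          ⟦ hasContent (u ++ w) m ⟧ * Y ≈ ∑ (λ a → ⟦ hasContent w a ⟧ * (⟦ hasContent (u ++ w) m ⟧ * Y)) (box n m)
        by-cases (yes u++w≗m) = begin
          ⟦ hasContent (u ++ w) m ⟧ * Y                                   ≈⟨ *-identityˡ _ ⟨
          1# * (⟦ hasContent (u ++ w) m ⟧ * Y)                            ≈⟨ *-congʳ (∑-box-δ m (λ i → count i w) w≤m) ⟨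
          ∑ (λ a → ⟦ hasContent w a ⟧) (box n m) * (⟦ hasContent (u ++ w) m ⟧ * Y) ≈⟨ ∑-*ʳ _ _ (box n m) ⟩
          ∑ (λ a → ⟦ hasContent w a ⟧ * (⟦ hasContent (u ++ w) m ⟧ * Y)) (box n m) ∎
          where
          w≤m : ∀ i → count i w ≤ m i
          w≤m i = ≡.subst (count i w ≤_) (≡.trans (≡.sym (count-++ i u w)) (u++w≗m i)) (NP.m≤n+m _ _)
        by-cases (no u++w≉m) = trans (*-congʳ 0≈) (trans (zeroˡ _)
          (sym (∑-0 _ (box n m) (λ a → trans (*-congˡ (trans (*-congʳ 0≈) (zeroˡ _))) (zeroʳ _)))))
          where
          0≈ : ⟦ hasContent (u ++ w) m ⟧ ≈ 0#
          0≈ = ⟦⟧-no (hasContent (u ++ w) m) u++w≉m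

      -- Once w has content a ≤ m, u·w has content m iff u has content m - a.
      split-content : ∀ a → (∀ i → a i ≤ m i) → ∀ u w (Z : Carrier) →
        ⟦ hasContent w a ⟧ * (⟦ hasContent (u ++ w) m ⟧ * (⟦ linked? Fin._<?_ u ⟧ * Z)) ≈
        (⟦ hasContent w a ⟧ * Z) * ⟦ increasingWord? 0 (rest a) u ⟧
      split-content a a≤m u w Z = trans (⟦⟧-guard (hasContent w a) given-tail) (sym (*-assoc _ _ _))
        where
        given-tail : (∀ i → count i w ≡ a i) →
          ⟦ hasContent (u ++ w) m ⟧ * (⟦ linked? Fin._<?_ u ⟧ * Z) ≈ Z * ⟦ increasingWord? 0 (rest a) u ⟧
        given-tail w≗a = begin
          ⟦ hasContent (u ++ w) m ⟧ * (⟦ linked? Fin._<?_ u ⟧ * Z)  ≈⟨ *-assoc _ _ _ ⟨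
          (⟦ hasContent (u ++ w) m ⟧ * ⟦ linked? Fin._<?_ u ⟧) * Z  ≈⟨ *-congʳ (*-comm _ _) ⟩
          (⟦ linked? Fin._<?_ u ⟧ * ⟦ hasContent (u ++ w) m ⟧) * Z
            ≈⟨ *-congʳ (*-congˡ (⟦⟧-iff (hasContent (u ++ w) m) (all? (λ x → 0 ≤? toℕ x) u ×-dec hasContent u (rest a)) to from)) ⟩
          (⟦ linked? Fin._<?_ u ⟧ * ⟦ all? (λ x → 0 ≤? toℕ x) u ×-dec hasContent u (rest a) ⟧) * Z
            ≈⟨ *-congʳ (⟦⟧-× (increasingWord? 0 (rest a) u) (linked? Fin._<?_ u) (all? (λ x → 0 ≤? toℕ x) u ×-dec hasContent u (rest a)) id _,_) ⟨
          ⟦ increasingWord? 0 (rest a) u ⟧ * Z                       ≈⟨ *-comm _ _ ⟩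
          Z * ⟦ increasingWord? 0 (rest a) u ⟧ ∎
          where
          to : (∀ i → count i (u ++ w) ≡ m i) → All (λ x → 0 ≤ toℕ x) u × (∀ i → count i u ≡ rest a i)
          to u++w≗m = All.tabulate (λ _ → z≤n) , λ i →
            ≡.trans (≡.sym (NP.m+n∸n≡m (count i u) (a i)))
                    (≡.cong (_∸ a i) (≡.trans (≡.cong (count i u +ℕ_) (≡.sym (w≗a i)))
                                              (≡.trans (≡.sym (count-++ i u w)) (u++w≗m i))))
          from : All (λ x → 0 ≤ toℕ x) u × (∀ i → count i u ≡ rest a i) → ∀ i → count i (u ++ w) ≡ m i
          from (_ , u≗m-a) i = ≡.trans (count-++ i u w)
                                 (≡.trans (≡.cong₂ _+ℕ_ (u≗m-a i) (w≗a i)) (NP.m∸n+n≡m (a≤m i)))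

      ≤1? : (b : Fin n → ℕ) → Dec (∀ i → b i ≤ 1)
      ≤1? b = FinP.all? (λ i → b i ≤? 1)

      indicator-from-0 : ∀ (b : Fin n → ℕ) k → ⟦ indicator? 0 b k ⟧ ≈ ⟦ ≤1? b ⟧ * ⟦ size b ≟ k ⟧
      indicator-from-0 b k = trans (⟦⟧-× (indicator? 0 b k) (≤1? b) (size b ≟ k ×-dec below0?) id _,_)
        (*-congˡ (⟦⟧-iff (size b ≟ k ×-dec below0?) (size b ≟ k) proj₁ (λ |b|≡k → |b|≡k , (λ i ()))))
        where
        below0? : Dec (∀ i → toℕ i < 0 → b i ≡ 0)
        below0? = FinP.all? (λ i → (toℕ i <? 0) →-dec (b i ≟ 0))

      -- The k-th term summed over the words of content m with tail content a.
      Φ : ℕ → ℕ → (Fin n → ℕ) → Carrier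
      Φ L k a = ⟦ ≤1? (rest a) ⟧ * (⟦ size (rest a) ≟ k ⟧ * (c k * gₗ (L ∸ k) a))

      -- For fixed a ≤ m, the prefixes u are counted by increasing-count.
      fixed-tail : ∀ j k a → (∀ i → a i ≤ m i) →
        ∑ (λ w → ∑ (λ u → ⟦ hasContent w a ⟧ * (⟦ hasContent (u ++ w) m ⟧ * (⟦ linked? Fin._<?_ u ⟧ * (c k * pow t (α r w)))))
                   (allWords n k)) (allWords n j) ≈
        ⟦ ≤1? (rest a) ⟧ * (⟦ size (rest a) ≟ k ⟧ * (c k * gₗ j a))
      fixed-tail j k a a≤m = begin
        ∑ (λ w → ∑ (λ u → ⟦ hasContent w a ⟧ * (⟦ hasContent (u ++ w) m ⟧ * (⟦ linked? Fin._<?_ u ⟧ * X w))) Wk) Wj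
          ≈⟨ ∑-cong Wj (λ w → ∑-cong Wk (λ u → split-content a a≤m u w (X w))) ⟩
        ∑ (λ w → ∑ (λ u → (⟦ hasContent w a ⟧ * X w) * ⟦ increasingWord? 0 (rest a) u ⟧) Wk) Wj
          ≈⟨ ∑-cong Wj (λ w → sym (∑-*ˡ _ (λ u → ⟦ increasingWord? 0 (rest a) u ⟧) Wk)) ⟩
        ∑ (λ w → (⟦ hasContent w a ⟧ * X w) * ∑ (λ u → ⟦ increasingWord? 0 (rest a) u ⟧) Wk) Wj
          ≈⟨ ∑-cong Wj (λ w → *-congˡ (increasing-count k 0 (rest a))) ⟩
        ∑ (λ w → (⟦ hasContent w a ⟧ * X w) * ⟦ indicator? 0 (rest a) k ⟧) Wj
          ≈⟨ ∑-*ʳ _ (λ w → ⟦ hasContent w a ⟧ * X w) Wj ⟨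
        ∑ (λ w → ⟦ hasContent w a ⟧ * X w) Wj * ⟦ indicator? 0 (rest a) k ⟧
          ≈⟨ *-congʳ (trans (∑-cong Wj (λ w → x*[y*z]≈y*[x*z] _ _ _)) (sym (∑-*ˡ (c k) (λ w → ⟦ hasContent w a ⟧ * pow t (α r w)) Wj))) ⟩
        (c k * gₗ j a) * ⟦ indicator? 0 (rest a) k ⟧
          ≈⟨ *-congˡ (indicator-from-0 (rest a) k) ⟩
        (c k * gₗ j a) * (⟦ ≤1? (rest a) ⟧ * ⟦ size (rest a) ≟ k ⟧)
          ≈⟨ trans (*-comm _ _) (*-assoc _ _ _) ⟩
        ⟦ ≤1? (rest a) ⟧ * (⟦ size (rest a) ≟ k ⟧ * (c k * gₗ j a)) ∎
        where
        Wk Wj : List (List (Fin n))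
        Wk = allWords n k
        Wj = allWords n j
        X : List (Fin n) → Carrier
        X w = c k * pow t (α r w)
        x*[y*z]≈y*[x*z] : ∀ x y z → x * (y * z) ≈ y * (x * z)
        x*[y*z]≈y*[x*z] x y z = trans (sym (*-assoc _ _ _)) (trans (*-congʳ (*-comm _ _)) (*-assoc _ _ _))

      -- Σ_{v ∈ [n]^L} [v has content m] · term k v = Σ_{a ≤ m} Φ L k a,
      -- cutting v = u·w with |u| = k.
      sum-term : ∀ L k → k ≤ L →
        ∑ (λ v → ⟦ hasContent v m ⟧ * term k v) (allWords n L) ≈ ∑ (λ a → Φ L k a) (box n m)
      sum-term L k k≤L = begin
        ∑ f (allWords n L)                    ≡⟨ ≡.cong (λ z → ∑ f (allWords n z)) (NP.m+[n∸m]≡n k≤L) ⟨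
        ∑ f (allWords n (k +ℕ j))             ≈⟨ ∑-words-split k j f ⟩
        ∑ (λ u → ∑ (λ w → f (u ++ w)) Wj) Wk
          ≈⟨ ∑-words-cong k (λ u |u|≡k → ∑-cong Wj (λ w → trans (*-congˡ (reflexive (term-++ k u w |u|≡k)))
                                                                  (insert-box u w _))) ⟩
        ∑ (λ u → ∑ (λ w → ∑ (λ a → F u w a) (box n m)) Wj) Wk
          ≈⟨ ∑-cong Wk (λ u → ∑-swap (λ w a → F u w a) Wj (box n m)) ⟩
        ∑ (λ u → ∑ (λ a → ∑ (λ w → F u w a) Wj) (box n m)) Wk
          ≈⟨ ∑-swap (λ u a → ∑ (λ w → F u w a) Wj) Wk (box n m) ⟩
        ∑ (λ a → ∑ (λ u → ∑ (λ w → F u w a) Wj) Wk) (box n m)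
          ≈⟨ ∑-cong (box n m) (λ a → ∑-swap (λ u w → F u w a) Wk Wj) ⟩
        ∑ (λ a → ∑ (λ w → ∑ (λ u → F u w a) Wk) Wj) (box n m)
          ≈⟨ ∑-box-cong m (λ a a≤m → fixed-tail j k a a≤m) ⟩
        ∑ (λ a → Φ L k a) (box n m) ∎
        where
        j : ℕ
        j = L ∸ k
        Wk Wj : List (List (Fin n))
        Wk = allWords n k
        Wj = allWords n j
        f : List (Fin n) → Carrier
        f v = ⟦ hasContent v m ⟧ * term k v
        F : List (Fin n) → List (Fin n) → (Fin n → ℕ) → Carrier
        F u w a = ⟦ hasContent w a ⟧ * (⟦ hasContent (u ++ w) m ⟧ * (⟦ linked? Fin._<?_ u ⟧ * (c k * pow t (α r w))))

      -- Σ_{k=1}^{|m|} Φ |m| k a = g(a) · C(m - a): only k = |m - a| contributes.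
      sum-over-k : ∀ a → (∀ i → a i ≤ m i) → ∑ (λ k → Φ (size m) k a) (range 1 (size m)) ≈ g n r t a * C (rest a)
      sum-over-k a a≤m = trans (sym (∑-*ˡ _ (λ k → ⟦ size (rest a) ≟ k ⟧ * (c k * gₗ (L ∸ k) a)) (range 1 L)))
                               (by-size (size (rest a)) ≡.refl)
        where
        L : ℕ
        L = size m
        |m-a|+|a|≡L : size (rest a) +ℕ size a ≡ L
        |m-a|+|a|≡L = size-∸ m a a≤m
        by-size : ∀ s → size (rest a) ≡ s →
          ⟦ ≤1? (rest a) ⟧ * ∑ (λ k → ⟦ size (rest a) ≟ k ⟧ * (c k * gₗ (L ∸ k) a)) (range 1 L) ≈ g n r t a * C (rest a)
        by-size zero |m-a|≡0 = begin
          ⟦ ≤1? (rest a) ⟧ * ∑ (λ k → ⟦ size (rest a) ≟ k ⟧ * (c k * gₗ (L ∸ k) a)) (range 1 L)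
            ≈⟨ *-congˡ (∑-range-δ-below (λ k → c k * gₗ (L ∸ k) a) (size (rest a)) 1 L (≡.subst (_< 1) (≡.sym |m-a|≡0) (s≤s z≤n))) ⟩
          ⟦ ≤1? (rest a) ⟧ * 0#  ≈⟨ zeroʳ _ ⟩
          0#                     ≈⟨ trans (*-congˡ (trans (*-congˡ (reflexive (≡.cong c |m-a|≡0))) (zeroʳ _))) (zeroʳ _) ⟨
          g n r t a * C (rest a) ∎
        by-size (suc _) |m-a|≡s = begin
          ⟦ ≤1? (rest a) ⟧ * ∑ (λ k → ⟦ size (rest a) ≟ k ⟧ * (c k * gₗ (L ∸ k) a)) (range 1 L)
            ≈⟨ *-congˡ (∑-range-δ (λ k → c k * gₗ (L ∸ k) a) (size (rest a)) 1 L (≡.subst (1 ≤_) (≡.sym |m-a|≡s) (s≤s z≤n))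
                                  (s≤s (≡.subst (size (rest a) ≤_) |m-a|+|a|≡L (NP.m≤m+n _ _)))) ⟩
          ⟦ ≤1? (rest a) ⟧ * (c (size (rest a)) * gₗ (L ∸ size (rest a)) a)
            ≡⟨ ≡.cong (λ z → ⟦ ≤1? (rest a) ⟧ * (c (size (rest a)) * gₗ z a))
                      (≡.trans (≡.cong (_∸ size (rest a)) (≡.sym |m-a|+|a|≡L)) (NP.m+n∸m≡n (size (rest a)) (size a))) ⟩
          ⟦ ≤1? (rest a) ⟧ * (c (size (rest a)) * gₗ (size a) a)  ≈⟨ *-congˡ (*-congˡ (g-unfold n r t a)) ⟨
          ⟦ ≤1? (rest a) ⟧ * (c (size (rest a)) * g n r t a)      ≈⟨ *-congˡ (*-comm _ _) ⟩
          ⟦ ≤1? (rest a) ⟧ * (g n r t a * c (size (rest a)))      ≈⟨ trans (sym (*-assoc _ _ _)) (trans (*-congʳ (*-comm _ _)) (*-assoc _ _ _)) ⟩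
          g n r t a * C (rest a) ∎

      g-recursion : 1 ≤ size m → g n r t m ≈ (G n r t ⊛ C) m
      g-recursion |m|≥1 = begin
        g n r t m                                                        ≈⟨ g-unfold n r t m ⟩
        ∑ (λ v → ⟦ hasContent v m ⟧ * pow t (α r v)) (allWords n L)
          ≈⟨ ∑-words-cong L (λ v |v|≡L → *-congˡ (trans (weight-expansion v (≡.subst (1 ≤_) (≡.sym |v|≡L) |m|≥1))
                                                        (reflexive (≡.cong (λ z → ∑ (λ k → term k v) (range 1 z)) |v|≡L)))) ⟩
        ∑ (λ v → ⟦ hasContent v m ⟧ * ∑ (λ k → term k v) (range 1 L)) (allWords n L)
          ≈⟨ ∑-cong (allWords n L) (λ v → ∑-*ˡ _ (λ k → term k v) (range 1 L)) ⟩
        ∑ (λ v → ∑ (λ k → ⟦ hasContent v m ⟧ * term k v) (range 1 L)) (allWords n L)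
          ≈⟨ ∑-swap (λ v k → ⟦ hasContent v m ⟧ * term k v) (allWords n L) (range 1 L) ⟩
        ∑ (λ k → ∑ (λ v → ⟦ hasContent v m ⟧ * term k v) (allWords n L)) (range 1 L)
          ≈⟨ ∑-range-cong 1 L (λ k _ k< → sum-term L k (NP.≤-pred k<)) ⟩
        ∑ (λ k → ∑ (λ a → Φ L k a) (box n m)) (range 1 L)                ≈⟨ ∑-swap (λ k a → Φ L k a) (range 1 L) (box n m) ⟩
        ∑ (λ a → ∑ (λ k → Φ L k a) (range 1 L)) (box n m)                ≈⟨ ∑-box-cong m sum-over-k ⟩
        ∑ (λ a → g n r t a * C (rest a)) (box n m) ∎
        where
        L : ℕ
        L = size m

    -- Coefficientwise G - G·C = 1: the constant term is g(0) - 0 = 1 and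
    -- every other coefficient vanishes by the recursion.
    G-G⊛C≈𝟙 : ∀ {n} (m : Fin n → ℕ) → g n r t m - (G n r t ⊛ C) m ≈ 𝟙 m
    G-G⊛C≈𝟙 {n} m = by-cases (FinP.all? (λ i → m i ≟ 0))
      where
      by-cases : Dec (∀ i → m i ≡ 0) → g n r t m - (G n r t ⊛ C) m ≈ 𝟙 m
      by-cases (yes m≡0) = begin
        g n r t m - (G n r t ⊛ C) m ≈⟨ +-cong (g-empty n r t m (s≤s z≤n) m≡0) (-‿cong (G⊛C-empty m m≡0)) ⟩
        1# - 0#                     ≈⟨ trans (+-congˡ -0#≈0#) (+-identityʳ _) ⟩
        1#                          ≈⟨ ⟦⟧-yes (FinP.all? (λ i → m i ≟ 0)) m≡0 ⟨
        𝟙 m ∎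
      by-cases (no m≢0) = begin
        g n r t m - (G n r t ⊛ C) m ≈⟨ +-congʳ (Recursion.g-recursion m |m|≥1) ⟩
        (G n r t ⊛ C) m - (G n r t ⊛ C) m ≈⟨ -‿inverseʳ _ ⟩
        0#                          ≈⟨ ⟦⟧-no (FinP.all? (λ i → m i ≟ 0)) m≢0 ⟨
        𝟙 m ∎
        where
        |m|≥1 : 1 ≤ size m
        |m|≥1 = NP.n≢0⇒n>0 (λ |m|≡0 → m≢0 (size-zero⁻ m |m|≡0))

theorem2 : ∀ {c ℓ} (R : CommutativeRing c ℓ) (n r : ℕ) → 1 ≤ n → 2 ≤ r →
    (t : CommutativeRing.Carrier R) → (m : Fin n → ℕ) →
    CommutativeRing._≈_ R (Series._⊛_ R (Series.G R n r t) (Series.D R n r t) m) (Series.𝟙 R m)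
theorem2 R n (suc zero)     _ (s≤s ()) t m
theorem2 R n (suc (suc r')) _ _        t m = begin
  (G n r t ⊛ D n r t) m               ≈⟨ ⊛-congʳ (G n r t) (D n r t) (𝟙 ⊕ (⊖ C)) D≈𝟙-C m ⟩
  (G n r t ⊛ (𝟙 ⊕ (⊖ C))) m           ≈⟨ ⊛-1- (G n r t) C m ⟩
  (G n r t ⊛ 𝟙) m - (G n r t ⊛ C) m   ≈⟨ +-congʳ (⊛-identityʳ (G n r t) (g-cong n r t) m) ⟩
  g n r t m - (G n r t ⊛ C) m         ≈⟨ G-G⊛C≈𝟙 m ⟩
  𝟙 m ∎
  where
  open CommutativeRing R
  open Series R
  open Proof R
  open Pattern r' t
  open import Relation.Binary.Reasoning.Setoid setoid
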